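{- Let $P$ be a process of the calculus $\mathsf{s}\pi^{+}$ and $\Gamma$ a typing context such that $P \vdash \Gamma$. Then for every process $Q$: if $P \equiv Q$ then $Q \vdash \Gamma$; and for every $Q$ and every non-empty set of names $S$, if $P \leadsto_S Q$ then $Q \vdash \Gamma$.
   Context: The calculus $\mathsf{s}\pi^{+}$ (a session-typed $\pi$-calculus with non-deterministic choice). Names are $x,y,z,w,\dots$; $\widetilde{x}$ is a finite tuple of names. Processes: $P,Q ::= \mathbf{0}$ (inaction) $\mid [x\leftrightarrow y]$ (forwarder) $\mid (\nu x)(P \mid Q)$ (connect) $\mid P \boxplus Q$ (non-deterministic choice) $\mid \overline{x}[y];(P\mid Q)$ (output of a fresh name $y$) $\mid x(y);P$ (input) $\mid \overline{x}\triangleleft \ell;P$ (select label $\ell$) $\mid x\triangleright\{i:P_i\}_{i\in I}$ (branch, $I$ finite) $\mid \overline{x}[\,]$ (close) $\mid x();P$ (wait) $\mid x.\mathtt{some}_{(w_1,\dots,w_n)};P$ (expect) $\mid \overline{x}.\mathtt{some};P$ (available) $\mid \overline{x}.\mathtt{none}$ (unavailable) $\mid P\mid Q$ (parallel). Name $y$ is bound in $(\nu y)(P\mid Q)$, $\overline{x}[y];(P\mid Q)$, $x(y);P$; $\mathrm{fn}(P)$ is the set of free names. $\boxplus$ is associative; $\boxplus_{i\in I}P_i$ is the choice among all $P_i$. $P\{y/z\}$ is capture-avoiding substitution. In the subscript of expect, names and sets of names are freely combined (union). Structural congruence $\equiv$ is the least congruence with: $P\equiv P'$ if $\alpha$-equivalent;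 $[x\leftrightarrow y]\equiv[y\leftrightarrow x]$; $P\mid \mathbf 0\equiv P$; $(P\mid Q)\mid R\equiv P\mid(Q\mid R)$; $P\mid Q\equiv Q\mid P$; $(\nu x)(P\mid Q)\equiv(\nu x)(Q\mid P)$; $P\boxplus P\equiv P$; $P\boxplus Q\equiv Q\boxplus P$; $(P\boxplus Q)\boxplus R\equiv P\boxplus(Q\boxplus R)$; $(\nu x)((P\mid Q)\mid R)\equiv(\nu x)(P\mid R)\mid Q$ if $x\notin\mathrm{fn}(Q)$; $(\nu x)((\nu y)(P\mid Q)\mid R)\equiv(\nu y)((\nu x)(P\mid R)\mid Q)$ if $x\notin\mathrm{fn}(Q)$, $y\notin\mathrm{fn}(R)$. ND-contexts: $N ::= [\cdot]\mid N\mid P\mid (\nu x)(N\mid P)\mid N\boxplus P$; D-contexts $C,D$ are ND-contexts not using the clause $N\boxplus P$. $N[P]$ is hole-filling. Prefixes: $\alpha,\beta ::= \overline{x}[y]\mid x(y)\mid \overline{x}\triangleleft\ell\mid x\triangleright\mid \overline{x}[\,]\mid x()\mid \overline{x}.\mathtt{some}\mid\overline{x}.\mathtt{none}\mid x.\mathtt{some}_{\widetilde{w}}\mid[x\leftrightarrow y]$, with subjects $\mathrm{sub}([x\leftrightarrow y])=\{x,y\}$ and $\mathrm{sub}(\alpha)=\{x\}$ otherwise; $\alpha;P$ denotes a prefixed process. Let $\bowtie$ be the least relation with $\overline{x}[y]\bowtie\overline{x}[z]$, $x(y)\bowtie x(z)$, and $\alpha\bowtie\alpha$. Precongruence $P \succeq_S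 Q$ (for non-empty $S\subseteq\{x,y\}$) holds when: (1) if $S=\{x\}$ then $P=(\boxplus_{i\in I}C_i[\alpha_i;P_i])\boxplus(\boxplus_{j\in J}C_j[\beta_j;Q_j])$ and $Q=\boxplus_{i\in I}C_i[\alpha_i;P_i]$ with all $\alpha_i\bowtie\alpha_{i'}$, $\mathrm{sub}(\alpha_i)=\{x\}$, and for all $i,j$: $\alpha_i\not\bowtie\beta_j$ and $x\in\mathrm{fn}(\beta_j;Q_j)$; (2) if $S=\{x,y\}$ then $P=(\boxplus_{i\in I}C_i[[x\leftrightarrow y]])\boxplus(\boxplus_{j\in J}C_j[[x\leftrightarrow z_j]])\boxplus(\boxplus_{k\in K}C_k[\alpha_k;P_k])$ and $Q=\boxplus_{i\in I}C_i[[x\leftrightarrow y]]$ with $z_j\neq y$, $x\in\mathrm{fn}(\alpha_k;P_k)$ and $\alpha_k\not\bowtie[x\leftrightarrow z]$ for all $z$. (Here $C_i,C_j,C_k,D_j$ are D-contexts.) Reduction $\leadsto_S$ (writing $\leadsto_{x}$ for $\leadsto_{\{x\}}$): (Id) $(\nu x)(\boxplus_{i\in I}C_i[[x\leftrightarrow y]]\mid Q)\leadsto_{x,y}\boxplus_{i\in I}C_i[Q\{y/x\}]$. (Comm) $(\nu x)(\boxplus_{i}C_i[\overline{x}[y_i];(P_i\mid Q_i)]\mid\boxplus_{j}D_j[x(z);R_j])\leadsto_x\boxplus_i C_i[(\nu x)(Q_i\mid(\nu w)(P_i\{w/y_i\}\mid\boxplus_j D_j[R_j\{w/z\}]))]$.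 (Sel) $(\nu x)(\boxplus_iC_i[\overline{x}\triangleleft k';P_i]\mid\boxplus_jD_j[x\triangleright\{k:Q^k_j\}_{k\in K}])\leadsto_x(\nu x)(\boxplus_iC_i[P_i]\mid\boxplus_jD_j[Q^{k'}_j])$ if $k'\in K$. (Close) $(\nu x)(\boxplus_iC_i[\overline{x}[\,]]\mid\boxplus_jD_j[x();Q_j])\leadsto_x\boxplus_iC_i[\mathbf 0]\mid\boxplus_jD_j[Q_j]$. (Some) $(\nu x)(\boxplus_iC_i[\overline{x}.\mathtt{some};P_i]\mid\boxplus_jD_j[x.\mathtt{some}_{(w_1,\dots,w_n)};Q_j])\leadsto_x(\nu x)(\boxplus_iC_i[P_i]\mid\boxplus_jD_j[Q_j])$. (None) $(\nu x)(\boxplus_iC_i[\overline{x}.\mathtt{none}]\mid\boxplus_jD_j[x.\mathtt{some}_{(w_1,\dots,w_n)};Q_j])\leadsto_x\boxplus_iC_i[\mathbf 0]\mid\boxplus_jD_j[\overline{w_1}.\mathtt{none}\mid\dots\mid\overline{w_n}.\mathtt{none}]$. ($\succeq$) if $x\in S$, $P\succeq_S P'$, $Q\succeq_S Q'$ and $(\nu x)(P'\mid Q')\leadsto_S R$ then $(\nu x)(P\mid Q)\leadsto_S R$. ($\nu\boxplus$) if $(\nu x)(P\mid N[C[Q_1]\boxplus C[Q_2]])\leadsto_S R$ then $(\nu x)(P\mid N[C[Q_1\boxplus Q_2]])\leadsto_S R$. Closure: if $P\equiv P'\leadsto_S Q'\equiv Q$ then $P\leadsto_S Q$; if $P\leadsto_S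 P'$ then $(\nu x)(P\mid Q)\leadsto_S(\nu x)(P'\mid Q)$, $P\mid Q\leadsto_S P'\mid Q$, and $P\boxplus Q\leadsto_S P'\boxplus Q$. Session types: $A,B::=\mathbf 1\mid\bot\mid A\otimes B\mid A\wp B\mid\oplus\{i:A_i\}_{i\in I}\mid\&\{i:A_i\}_{i\in I}\mid\& A\mid\oplus A$ ($\wp$ is the multiplicative disjunction "par"). Duality $\overline{\cdot}$: $\overline{\mathbf 1}=\bot$, $\overline{\bot}=\mathbf 1$, $\overline{A\otimes B}=\overline A\wp\overline B$, $\overline{A\wp B}=\overline A\otimes\overline B$, $\overline{\oplus\{i:A_i\}}=\&\{i:\overline{A_i}\}$, $\overline{\&\{i:A_i\}}=\oplus\{i:\overline{A_i}\}$, $\overline{\&A}=\oplus\overline A$, $\overline{\oplus A}=\&\overline A$. Contexts $\Gamma$ are finite sets of assignments $x:A$ with distinct names; $\&\Gamma$ means every type in $\Gamma$ has the form $\&A'$. Typing rules for $P\vdash\Gamma$: (cut) from $P\vdash\Gamma,x:A$ and $Q\vdash\Delta,x:\overline A$ infer $(\nu x)(P\mid Q)\vdash\Gamma,\Delta$; (mix) from $P\vdash\Gamma$, $Q\vdash\Delta$ infer $P\mid Q\vdash\Gamma,\Delta$; ($\boxplus$) from $P\vdash\Gamma$, $Q\vdash\Gamma$ infer $P\boxplus Q\vdash\Gamma$; $\mathbf 0\vdash\emptyset$; $[x\leftrightarrow y]\vdash x:A,y:\overline A$; $\overline{x}[\,]\vdash x:\mathbf 1$; from $P\vdash\Gamma$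 infer $x();P\vdash\Gamma,x:\bot$; from $P\vdash\Gamma,y:A$ and $Q\vdash\Delta,x:B$ infer $\overline{x}[y];(P\mid Q)\vdash\Gamma,\Delta,x:A\otimes B$; from $P\vdash\Gamma,y:A,x:B$ infer $x(y);P\vdash\Gamma,x:A\wp B$; from $P\vdash\Gamma,x:A_j$, $j\in I$ infer $\overline{x}\triangleleft j;P\vdash\Gamma,x:\oplus\{i:A_i\}_{i\in I}$; from $P_i\vdash\Gamma,x:A_i$ for all $i\in I$ infer $x\triangleright\{i:P_i\}_{i\in I}\vdash\Gamma,x:\&\{i:A_i\}_{i\in I}$; from $P\vdash\Gamma,x:A$ infer $\overline{x}.\mathtt{some};P\vdash\Gamma,x:\&A$; $\overline{x}.\mathtt{none}\vdash x:\&A$; from $P\vdash\&\Gamma,x:A$ infer $x.\mathtt{some}_{\mathrm{dom}(\Gamma)};P\vdash\&\Gamma,x:\oplus A$. -}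

module Defs where

open import Data.Nat using (ℕ; zero; suc; _≤_; _⊔_; _≟_)
open import Data.Bool using (Bool; true; false; if_then_else_)
open import Data.Maybe using (Maybe; just; nothing)
open import Data.Product using (Σ; ∃; ∃-syntax; _×_; _,_; proj₁; proj₂)
open import Data.List using (List; []; _∷_; _++_; map; filter; foldr)
open import Data.List.NonEmpty using (List⁺; _∷_; toList)
  renaming (map to map⁺)
open import Data.List.Membership.Propositional using (_∈_; _∉_)
open import Data.List.Relation.Unary.All using (All)
open import Data.List.Relation.Unary.Unique.Propositional using (Unique)
open import Data.List.Relation.Binary.Permutation.Propositional using (_↭_)
open import Relation.Nullary using (¬_; does; ¬?)
open import Relation.Binary.PropositionalEquality using (_≡_; _≢_)

Name : Set
Name = ℕ

Label : Set
Label = ℕ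

_==_ : Name → Name → Bool
x == y = does (x ≟ y)

-- Branching  x ▷ {i : P_i}_{i∈I}  is indexed by a finite, NON-EMPTY set of
-- labels, represented canonically as a strictly increasing list of labels
-- (Br b : a family whose labels are all ≥ b).

data Proc : Set
data Br (b : ℕ) : Set

data Proc where
  inact  : Proc
  fwd    : Name → Name → Proc
  nu     : Name → Proc → Proc → Proc             -- (ν x)(P | Q)   (x bound in P and Q)
  _⊞_    : Proc → Proc → Proc
  out    : Name → Name → Proc → Proc → Proc      -- x̄[y];(P | Q)   (y bound in P)
  inp    : Name → Name → Proc → Proc             -- x(y);P         (y bound in P)
  sel    : Name → Label → Proc → Proc
  bra    : Name → Br 0 → Proc
  close  : Name → Proc
  wait   : Name → Proc → Proc
  expect : Name → List Name → Proc → Proc        -- x.some_(w₁,…,wₙ);P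
  avail  : Name → Proc → Proc                    -- x̄.some;P
  unavail : Name → Proc                          -- x̄.none
  _∥_    : Proc → Proc → Proc

data Br b where
  one  : (ℓ : Label) → b ≤ ℓ → Proc → Br b
  more : (ℓ : Label) → b ≤ ℓ → Proc → Br (suc ℓ) → Br b

infixr 5 _⊞_
infixr 6 _∥_

remove : Name → List Name → List Name
remove y = filter (λ z → ¬? (z ≟ y))

fn  : Proc → List Name
fnB : ∀ {b} → Br b → List Name

fn inact = []
fn (fwd x y) = x ∷ y ∷ []
fn (nu x P Q) = remove x (fn P ++ fn Q)
fn (P ⊞ Q) = fn P ++ fn Q
fn (out x y P Q) = x ∷ (remove y (fn P) ++ fn Q)
fn (inp x y P) = x ∷ remove y (fn P)
fn (sel x ℓ P) = x ∷ fn P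
fn (bra x bs) = x ∷ fnB bs
fn (close x) = x ∷ []
fn (wait x P) = x ∷ fn P
fn (expect x ws P) = x ∷ (ws ++ fn P)
fn (avail x P) = x ∷ fn P
fn (unavail x) = x ∷ []
fn (P ∥ Q) = fn P ++ fn Q

fnB (one ℓ _ P) = fn P
fnB (more ℓ _ P bs) = fn P ++ fnB bs

names  : Proc → List Name
namesB : ∀ {b} → Br b → List Name

names inact = []
names (fwd x y) = x ∷ y ∷ []
names (nu x P Q) = x ∷ (names P ++ names Q)
names (P ⊞ Q) = names P ++ names Q
names (out x y P Q) = x ∷ y ∷ (names P ++ names Q)
names (inp x y P) = x ∷ y ∷ names P
names (sel x ℓ P) = x ∷ names P
names (bra x bs) = x ∷ namesB bs
names (close x) = x ∷ []
names (wait x P) = x ∷ names P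
names (expect x ws P) = x ∷ (ws ++ names P)
names (avail x P) = x ∷ names P
names (unavail x) = x ∷ []
names (P ∥ Q) = names P ++ names Q

namesB (one ℓ _ P) = names P
namesB (more ℓ _ P bs) = names P ++ namesB bs

_[_↦_] : (Name → Name) → Name → Name → (Name → Name)
(σ [ x ↦ w ]) z = if z == x then w else σ z

maxL : List ℕ → ℕ
maxL = foldr _⊔_ 0

freshFor : (Name → Name) → Proc → Name
freshFor σ R = suc (maxL (map σ (names R)))

ren  : (Name → Name) → Proc → Proc
renB : ∀ {b} → (Name → Name) → Br b → Br b

ren σ inact = inact
ren σ (fwd x y) = fwd (σ x) (σ y)
ren σ (nu x P Q) =
  nu (freshFor σ (nu x P Q))
     (ren (σ [ x ↦ freshFor σ (nu x P Q) ]) P)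
     (ren (σ [ x ↦ freshFor σ (nu x P Q) ]) Q)
ren σ (P ⊞ Q) = ren σ P ⊞ ren σ Q
ren σ (out x y P Q) =
  out (σ x) (freshFor σ P) (ren (σ [ y ↦ freshFor σ P ]) P) (ren σ Q)
ren σ (inp x y P) = inp (σ x) (freshFor σ P) (ren (σ [ y ↦ freshFor σ P ]) P)
ren σ (sel x ℓ P) = sel (σ x) ℓ (ren σ P)
ren σ (bra x bs) = bra (σ x) (renB σ bs)
ren σ (close x) = close (σ x)
ren σ (wait x P) = wait (σ x) (ren σ P)
ren σ (expect x ws P) = expect (σ x) (map σ ws) (ren σ P)
ren σ (avail x P) = avail (σ x) (ren σ P)
ren σ (unavail x) = unavail (σ x)
ren σ (P ∥ Q) = ren σ P ∥ ren σ Q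

renB σ (one ℓ p P) = one ℓ p (ren σ P)
renB σ (more ℓ p P bs) = more ℓ p (ren σ P) (renB σ bs)

_[_/_] : Proc → Name → Name → Proc
P [ y / x ] = ren (λ z → if z == x then y else z) P

swapN : Name → Name → Name → Name
swapN a b z = if z == a then b else (if z == b then a else z)

swap  : Name → Name → Proc → Proc
swapB : ∀ {c} → Name → Name → Br c → Br c

swap a b inact = inact
swap a b (fwd x y) = fwd (swapN a b x) (swapN a b y)
swap a b (nu x P Q) = nu (swapN a b x) (swap a b P) (swap a b Q)
swap a b (P ⊞ Q) = swap a b P ⊞ swap a b Q
swap a b (out x y P Q) = out (swapN a b x) (swapN a b y) (swap a b P) (swap a b Q)
swap a b (inp x y P) = inp (swapN a b x) (swapN a b y) (swap a b P)
swap a b (sel x ℓ P) = sel (swapN a b x) ℓ (swap a b P)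
swap a b (bra x bs) = bra (swapN a b x) (swapB a b bs)
swap a b (close x) = close (swapN a b x)
swap a b (wait x P) = wait (swapN a b x) (swap a b P)
swap a b (expect x ws P) = expect (swapN a b x) (map (swapN a b) ws) (swap a b P)
swap a b (avail x P) = avail (swapN a b x) (swap a b P)
swap a b (unavail x) = unavail (swapN a b x)
swap a b (P ∥ Q) = swap a b P ∥ swap a b Q

swapB a b (one ℓ p P) = one ℓ p (swap a b P)
swapB a b (more ℓ p P bs) = more ℓ p (swap a b P) (swapB a b bs)

data _=α_ : Proc → Proc → Set
data _=αᵇ_ {c : ℕ} : Br c → Br c → Set

data _=α_ where
  α-inact  : inact =α inact
  α-fwd    : ∀ {x y} → fwd x y =α fwd x y
  α-nu     : ∀ {x x' P P' Q Q'} (z : Name) →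
             z ∉ names (nu x P Q) → z ∉ names (nu x' P' Q') →
             swap x z P =α swap x' z P' → swap x z Q =α swap x' z Q' →
             nu x P Q =α nu x' P' Q'
  α-choice : ∀ {P P' Q Q'} → P =α P' → Q =α Q' → (P ⊞ Q) =α (P' ⊞ Q')
  α-out    : ∀ {x y y' P P' Q Q'} (z : Name) →
             z ∉ names (out x y P Q) → z ∉ names (out x y' P' Q') →
             swap y z P =α swap y' z P' → Q =α Q' →
             out x y P Q =α out x y' P' Q'
  α-inp    : ∀ {x y y' P P'} (z : Name) →
             z ∉ names (inp x y P) → z ∉ names (inp x y' P') →
             swap y z P =α swap y' z P' →
             inp x y P =α inp x y' P'
  α-sel    : ∀ {x ℓ P P'} → P =α P' → sel x ℓ P =α sel x ℓ P'
  α-bra    : ∀ {x bs bs'} → bs =αᵇ bs' → bra x bs =α bra x bs'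
  α-close  : ∀ {x} → close x =α close x
  α-wait   : ∀ {x P P'} → P =α P' → wait x P =α wait x P'
  α-expect : ∀ {x ws P P'} → P =α P' → expect x ws P =α expect x ws P'
  α-avail  : ∀ {x P P'} → P =α P' → avail x P =α avail x P'
  α-unavail : ∀ {x} → unavail x =α unavail x
  α-par    : ∀ {P P' Q Q'} → P =α P' → Q =α Q' → (P ∥ Q) =α (P' ∥ Q')

data _=αᵇ_ where
  α-one  : ∀ {ℓ p p' P P'} → P =α P' → one ℓ p P =αᵇ one ℓ p' P'
  α-more : ∀ {ℓ p p' P P' bs bs'} → P =α P' → bs =αᵇ bs' →
           more ℓ p P bs =αᵇ more ℓ p' P' bs'

data _≡ₛ_ : Proc → Proc → Set
data _≡ₛᵇ_ {c : ℕ} : Br c → Br c → Set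

infix 4 _≡ₛ_ _=α_

data _≡ₛ_ where
  s-refl  : ∀ {P} → P ≡ₛ P
  s-sym   : ∀ {P Q} → P ≡ₛ Q → Q ≡ₛ P
  s-trans : ∀ {P Q R} → P ≡ₛ Q → Q ≡ₛ R → P ≡ₛ R
  c-nu     : ∀ {x P P' Q Q'} → P ≡ₛ P' → Q ≡ₛ Q' → nu x P Q ≡ₛ nu x P' Q'
  c-choice : ∀ {P P' Q Q'} → P ≡ₛ P' → Q ≡ₛ Q' → (P ⊞ Q) ≡ₛ (P' ⊞ Q')
  c-out    : ∀ {x y P P' Q Q'} → P ≡ₛ P' → Q ≡ₛ Q' → out x y P Q ≡ₛ out x y P' Q'
  c-inp    : ∀ {x y P P'} → P ≡ₛ P' → inp x y P ≡ₛ inp x y P'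
  c-sel    : ∀ {x ℓ P P'} → P ≡ₛ P' → sel x ℓ P ≡ₛ sel x ℓ P'
  c-bra    : ∀ {x bs bs'} → bs ≡ₛᵇ bs' → bra x bs ≡ₛ bra x bs'
  c-wait   : ∀ {x P P'} → P ≡ₛ P' → wait x P ≡ₛ wait x P'
  c-expect : ∀ {x ws P P'} → P ≡ₛ P' → expect x ws P ≡ₛ expect x ws P'
  c-avail  : ∀ {x P P'} → P ≡ₛ P' → avail x P ≡ₛ avail x P'
  c-par    : ∀ {P P' Q Q'} → P ≡ₛ P' → Q ≡ₛ Q' → (P ∥ Q) ≡ₛ (P' ∥ Q')
  s-alpha     : ∀ {P Q} → P =α Q → P ≡ₛ Q
  s-fwd       : ∀ {x y} → fwd x y ≡ₛ fwd y x
  s-par-unit  : ∀ {P} → (P ∥ inact) ≡ₛ P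
  s-par-assoc : ∀ {P Q R} → ((P ∥ Q) ∥ R) ≡ₛ (P ∥ (Q ∥ R))
  s-par-comm  : ∀ {P Q} → (P ∥ Q) ≡ₛ (Q ∥ P)
  s-nu-comm   : ∀ {x P Q} → nu x P Q ≡ₛ nu x Q P
  s-ch-idem   : ∀ {P} → (P ⊞ P) ≡ₛ P
  s-ch-comm   : ∀ {P Q} → (P ⊞ Q) ≡ₛ (Q ⊞ P)
  s-ch-assoc  : ∀ {P Q R} → ((P ⊞ Q) ⊞ R) ≡ₛ (P ⊞ (Q ⊞ R))
  s-scope     : ∀ {x P Q R} → x ∉ fn Q →
                nu x (P ∥ Q) R ≡ₛ (nu x P R ∥ Q)
  s-nu-nu     : ∀ {x y P Q R} → x ∉ fn Q → y ∉ fn R →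
                nu x (nu y P Q) R ≡ₛ nu y (nu x P R) Q

data _≡ₛᵇ_ where
  c-one  : ∀ {ℓ p p' P P'} → P ≡ₛ P' → one ℓ p P ≡ₛᵇ one ℓ p' P'
  c-more : ∀ {ℓ p p' P P' bs bs'} → P ≡ₛ P' → bs ≡ₛᵇ bs' →
           more ℓ p P bs ≡ₛᵇ more ℓ p' P' bs'

data NCtx : Set where
  hole   : NCtx
  _∥ₙ_   : NCtx → Proc → NCtx
  nuₙ    : Name → NCtx → Proc → NCtx
  _⊞ₙ_   : NCtx → Proc → NCtx

plugN : NCtx → Proc → Proc
plugN hole R = R
plugN (N ∥ₙ P) R = plugN N R ∥ P
plugN (nuₙ x N P) R = nu x (plugN N R) P
plugN (N ⊞ₙ P) R = plugN N R ⊞ P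

data DCtx : Set where
  hole   : DCtx
  _∥ₙ_   : DCtx → Proc → DCtx
  nuₙ    : Name → DCtx → Proc → DCtx

plug : DCtx → Proc → Proc
plug hole R = R
plug (C ∥ₙ P) R = plug C R ∥ P
plug (nuₙ x C P) R = nu x (plug C R) P

bv : DCtx → List Name
bv hole = []
bv (C ∥ₙ P) = bv C
bv (nuₙ x C P) = x ∷ bv C

-- Barendregt convention: the context binds none of the given names
Avoids : DCtx → List Name → Set
Avoids C ns = ∀ {z} → z ∈ bv C → z ∉ ns

⊞-list : Proc → List Proc → Proc
⊞-list P [] = P
⊞-list P (Q ∷ Rs) = P ⊞ ⊞-list Q Rs

⊞⁺ : List⁺ Proc → Proc
⊞⁺ (P ∷ Ps) = ⊞-list P Ps

_⊞*_ : Proc → List Proc → Proc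
P ⊞* [] = P
P ⊞* (Q ∷ Qs) = P ⊞ ⊞⁺ (Q ∷ Qs)

data Prefix : Set where
  pOut     : Name → Name → Prefix
  pInp     : Name → Name → Prefix
  pSel     : Name → Label → Prefix
  pBra     : Name → Prefix
  pClose   : Name → Prefix
  pWait    : Name → Prefix
  pAvail   : Name → Prefix
  pUnavail : Name → Prefix
  pExpect  : Name → List Name → Prefix
  pFwd     : Name → Name → Prefix

pre : Proc → Maybe Prefix
pre (fwd x y) = just (pFwd x y)
pre (out x y P Q) = just (pOut x y)
pre (inp x y P) = just (pInp x y)
pre (sel x ℓ P) = just (pSel x ℓ)
pre (bra x bs) = just (pBra x)
pre (close x) = just (pClose x)
pre (wait x P) = just (pWait x)
pre (expect x ws P) = just (pExpect x ws)
pre (avail x P) = just (pAvail x)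
pre (unavail x) = just (pUnavail x)
pre inact = nothing
pre (nu x P Q) = nothing
pre (P ⊞ Q) = nothing
pre (P ∥ Q) = nothing

sub : Prefix → List Name
sub (pOut x _) = x ∷ []
sub (pInp x _) = x ∷ []
sub (pSel x _) = x ∷ []
sub (pBra x) = x ∷ []
sub (pClose x) = x ∷ []
sub (pWait x) = x ∷ []
sub (pAvail x) = x ∷ []
sub (pUnavail x) = x ∷ []
sub (pExpect x _) = x ∷ []
sub (pFwd x y) = x ∷ y ∷ []

data _⋈_ : Prefix → Prefix → Set where
  ⋈-out  : ∀ {x y z} → pOut x y ⋈ pOut x z
  ⋈-inp  : ∀ {x y z} → pInp x y ⋈ pInp x z
  ⋈-refl : ∀ {α} → α ⋈ α

-- C[α;P] : a D-context filled with a prefixed process, with its prefix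
record PItem : Set where
  constructor pitem
  field
    ctx   : DCtx
    pfx   : Prefix
    body  : Proc
    isPfx : pre body ≡ just pfx

fillI : PItem → Proc
fillI it = plug (PItem.ctx it) (PItem.body it)

-- Sets of names (labels S of the reduction) as lists, compared as sets

_≈ˢ_ : List Name → List Name → Set
S ≈ˢ T = ∀ z → (z ∈ S → z ∈ T) × (z ∈ T → z ∈ S)

data _⪰[_]_ : Proc → List Name → Proc → Set where
  pc-one : ∀ {S x} → S ≈ˢ (x ∷ []) →
    (I : List⁺ PItem) (J : List PItem) →
    (∀ {i} → i ∈ toList I → sub (PItem.pfx i) ≡ x ∷ []) →
    (∀ {i i'} → i ∈ toList I → i' ∈ toList I → PItem.pfx i ⋈ PItem.pfx i') →
    (∀ {i j} → i ∈ toList I → j ∈ J → ¬ (PItem.pfx i ⋈ PItem.pfx j)) →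
    (∀ {j} → j ∈ J → x ∈ fn (PItem.body j)) →
    (⊞⁺ (map⁺ fillI I) ⊞* map fillI J) ⪰[ S ] ⊞⁺ (map⁺ fillI I)
  pc-two : ∀ {S x y} → S ≈ˢ (x ∷ y ∷ []) → x ≢ y →
    (I : List⁺ DCtx) (J : List (DCtx × Name)) (K : List PItem) →
    (∀ {j} → j ∈ J → proj₂ j ≢ y) →
    (∀ {k} → k ∈ K → x ∈ fn (PItem.body k)) →
    (∀ {k} → k ∈ K → ∀ z → ¬ (PItem.pfx k ⋈ pFwd x z)) →
    ((⊞⁺ (map⁺ (λ C → plug C (fwd x y)) I)
        ⊞* map (λ j → plug (proj₁ j) (fwd x (proj₂ j))) J)
        ⊞* map fillI K)
      ⪰[ S ] ⊞⁺ (map⁺ (λ C → plug C (fwd x y)) I)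

noneAll : List Name → Proc
noneAll [] = inact
noneAll (w ∷ []) = unavail w
noneAll (w ∷ v ∷ ws) = unavail w ∥ noneAll (v ∷ ws)

-- (Comm): items C_i[x̄[y_i];(P_i | Q_i)] and D_j[x(z);R_j]
record OutItem : Set where
  constructor outItem
  field
    octx : DCtx
    oy   : Name
    oP   : Proc
    oQ   : Proc

record CtxProc : Set where
  constructor ctxProc
  field
    cctx  : DCtx
    cproc : Proc

-- (Sel): D_j[x ▷ {k : Q^k_j}_{k∈K}] together with the chosen Q^{k'}_j
record BraItem : Set where
  constructor braItem
  field
    bctx : DCtx
    bbr  : Br 0
    bsel : Proc

labelsB : ∀ {b} → Br b → List Label
labelsB (one ℓ _ _) = ℓ ∷ []
labelsB (more ℓ _ _ bs) = ℓ ∷ labelsB bs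

lookupB : ∀ {b} → Br b → Label → Maybe Proc
lookupB (one ℓ _ P) k = if k == ℓ then just P else nothing
lookupB (more ℓ _ P bs) k = if k == ℓ then just P else lookupB bs k

commL : Name → List⁺ OutItem → Name → List⁺ CtxProc → Proc
commL x Cs z Ds =
  nu x (⊞⁺ (map⁺ (λ c → plug (OutItem.octx c)
                     (out x (OutItem.oy c) (OutItem.oP c) (OutItem.oQ c))) Cs))
       (⊞⁺ (map⁺ (λ d → plug (CtxProc.cctx d) (inp x z (CtxProc.cproc d))) Ds))

commR : Name → List⁺ OutItem → Name → List⁺ CtxProc → Name → Proc
commR x Cs z Ds w =
  ⊞⁺ (map⁺ (λ c → plug (OutItem.octx c)
        (nu x (OutItem.oQ c)
              (nu w (OutItem.oP c [ w / OutItem.oy c ])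
                    (⊞⁺ (map⁺ (λ d → plug (CtxProc.cctx d)
                                        (CtxProc.cproc d [ w / z ])) Ds)))))
      Cs)

data _⇝[_]_ : Proc → List Name → Proc → Set where
  r-id : ∀ {S x y Q} → S ≈ˢ (x ∷ y ∷ []) → (Cs : List⁺ DCtx) →
    (∀ {C} → C ∈ toList Cs →
       Avoids C (x ∷ y ∷ fn (nu x (⊞⁺ (map⁺ (λ C → plug C (fwd x y)) Cs)) Q))) →
    nu x (⊞⁺ (map⁺ (λ C → plug C (fwd x y)) Cs)) Q
      ⇝[ S ] ⊞⁺ (map⁺ (λ C → plug C (Q [ y / x ])) Cs)
  r-comm : ∀ {S x} → S ≈ˢ (x ∷ []) →
    (Cs : List⁺ OutItem) (z : Name) (Ds : List⁺ CtxProc) (w : Name) →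
    (∀ {c} → c ∈ toList Cs → Avoids (OutItem.octx c) (x ∷ fn (commL x Cs z Ds))) →
    (∀ {d} → d ∈ toList Ds → Avoids (CtxProc.cctx d) (x ∷ fn (commL x Cs z Ds))) →
    w ∉ names (commL x Cs z Ds) →
    commL x Cs z Ds ⇝[ S ] commR x Cs z Ds w
  r-sel : ∀ {S x} → S ≈ˢ (x ∷ []) →
    (k' : Label) (Cs : List⁺ CtxProc) (K : List Label) (Ds : List⁺ BraItem) →
    (∀ {d} → d ∈ toList Ds → labelsB (BraItem.bbr d) ≡ K) →
    (∀ {d} → d ∈ toList Ds → lookupB (BraItem.bbr d) k' ≡ just (BraItem.bsel d)) →
    k' ∈ K →
    (∀ {c} → c ∈ toList Cs → Avoids (CtxProc.cctx c)
       (x ∷ fn (nu x (⊞⁺ (map⁺ (λ c → plug (CtxProc.cctx c) (sel x k' (CtxProc.cproc c))) Cs))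
                     (⊞⁺ (map⁺ (λ d → plug (BraItem.bctx d) (bra x (BraItem.bbr d))) Ds))))) →
    (∀ {d} → d ∈ toList Ds → Avoids (BraItem.bctx d)
       (x ∷ fn (nu x (⊞⁺ (map⁺ (λ c → plug (CtxProc.cctx c) (sel x k' (CtxProc.cproc c))) Cs))
                     (⊞⁺ (map⁺ (λ d → plug (BraItem.bctx d) (bra x (BraItem.bbr d))) Ds))))) →
    nu x (⊞⁺ (map⁺ (λ c → plug (CtxProc.cctx c) (sel x k' (CtxProc.cproc c))) Cs))
         (⊞⁺ (map⁺ (λ d → plug (BraItem.bctx d) (bra x (BraItem.bbr d))) Ds))
      ⇝[ S ]
    nu x (⊞⁺ (map⁺ (λ c → plug (CtxProc.cctx c) (CtxProc.cproc c)) Cs))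
         (⊞⁺ (map⁺ (λ d → plug (BraItem.bctx d) (BraItem.bsel d)) Ds))
  r-close : ∀ {S x} → S ≈ˢ (x ∷ []) →
    (Cs : List⁺ DCtx) (Ds : List⁺ CtxProc) →
    (∀ {C} → C ∈ toList Cs → Avoids C
       (x ∷ fn (nu x (⊞⁺ (map⁺ (λ C → plug C (close x)) Cs))
                     (⊞⁺ (map⁺ (λ d → plug (CtxProc.cctx d) (wait x (CtxProc.cproc d))) Ds))))) →
    (∀ {d} → d ∈ toList Ds → Avoids (CtxProc.cctx d)
       (x ∷ fn (nu x (⊞⁺ (map⁺ (λ C → plug C (close x)) Cs))
                     (⊞⁺ (map⁺ (λ d → plug (CtxProc.cctx d) (wait x (CtxProc.cproc d))) Ds))))) →
    nu x (⊞⁺ (map⁺ (λ C → plug C (close x)) Cs))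
         (⊞⁺ (map⁺ (λ d → plug (CtxProc.cctx d) (wait x (CtxProc.cproc d))) Ds))
      ⇝[ S ]
    (⊞⁺ (map⁺ (λ C → plug C inact) Cs)
      ∥ ⊞⁺ (map⁺ (λ d → plug (CtxProc.cctx d) (CtxProc.cproc d)) Ds))
  r-some : ∀ {S x} → S ≈ˢ (x ∷ []) →
    (Cs : List⁺ CtxProc) (ws : List Name) (Ds : List⁺ CtxProc) →
    (∀ {c} → c ∈ toList Cs → Avoids (CtxProc.cctx c)
       (x ∷ fn (nu x (⊞⁺ (map⁺ (λ c → plug (CtxProc.cctx c) (avail x (CtxProc.cproc c))) Cs))
                     (⊞⁺ (map⁺ (λ d → plug (CtxProc.cctx d) (expect x ws (CtxProc.cproc d))) Ds))))) →
    (∀ {d} → d ∈ toList Ds → Avoids (CtxProc.cctx d)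
       (x ∷ fn (nu x (⊞⁺ (map⁺ (λ c → plug (CtxProc.cctx c) (avail x (CtxProc.cproc c))) Cs))
                     (⊞⁺ (map⁺ (λ d → plug (CtxProc.cctx d) (expect x ws (CtxProc.cproc d))) Ds))))) →
    nu x (⊞⁺ (map⁺ (λ c → plug (CtxProc.cctx c) (avail x (CtxProc.cproc c))) Cs))
         (⊞⁺ (map⁺ (λ d → plug (CtxProc.cctx d) (expect x ws (CtxProc.cproc d))) Ds))
      ⇝[ S ]
    nu x (⊞⁺ (map⁺ (λ c → plug (CtxProc.cctx c) (CtxProc.cproc c)) Cs))
         (⊞⁺ (map⁺ (λ d → plug (CtxProc.cctx d) (CtxProc.cproc d)) Ds))
  r-none : ∀ {S x} → S ≈ˢ (x ∷ []) →
    (Cs : List⁺ DCtx) (ws : List Name) (Ds : List⁺ CtxProc) →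
    (∀ {C} → C ∈ toList Cs → Avoids C
       (x ∷ fn (nu x (⊞⁺ (map⁺ (λ C → plug C (unavail x)) Cs))
                     (⊞⁺ (map⁺ (λ d → plug (CtxProc.cctx d) (expect x ws (CtxProc.cproc d))) Ds))))) →
    (∀ {d} → d ∈ toList Ds → Avoids (CtxProc.cctx d)
       (x ∷ fn (nu x (⊞⁺ (map⁺ (λ C → plug C (unavail x)) Cs))
                     (⊞⁺ (map⁺ (λ d → plug (CtxProc.cctx d) (expect x ws (CtxProc.cproc d))) Ds))))) →
    nu x (⊞⁺ (map⁺ (λ C → plug C (unavail x)) Cs))
         (⊞⁺ (map⁺ (λ d → plug (CtxProc.cctx d) (expect x ws (CtxProc.cproc d))) Ds))
      ⇝[ S ]
    (⊞⁺ (map⁺ (λ C → plug C inact) Cs)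
      ∥ ⊞⁺ (map⁺ (λ d → plug (CtxProc.cctx d) (noneAll ws)) Ds))
  r-pre : ∀ {S x P P' Q Q' R} → x ∈ S →
    P ⪰[ S ] P' → Q ⪰[ S ] Q' → nu x P' Q' ⇝[ S ] R → nu x P Q ⇝[ S ] R
  r-nu-choice : ∀ {S x P R Q₁ Q₂} (N : NCtx) (C : DCtx) →
    nu x P (plugN N (plug C Q₁ ⊞ plug C Q₂)) ⇝[ S ] R →
    nu x P (plugN N (plug C (Q₁ ⊞ Q₂))) ⇝[ S ] R
  r-struct : ∀ {S P P' Q Q'} → P ≡ₛ P' → P' ⇝[ S ] Q' → Q' ≡ₛ Q → P ⇝[ S ] Q
  r-ctx-nu : ∀ {S x P P' Q} → P ⇝[ S ] P' → nu x P Q ⇝[ S ] nu x P' Q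
  r-ctx-par : ∀ {S P P' Q} → P ⇝[ S ] P' → (P ∥ Q) ⇝[ S ] (P' ∥ Q)
  r-ctx-choice : ∀ {S P P' Q} → P ⇝[ S ] P' → (P ⊞ Q) ⇝[ S ] (P' ⊞ Q)

-- Session types.  Labelled families {i : A_i}_{i∈I} are non-empty and
-- represented canonically with strictly increasing labels.

data Ty : Set
data TyFam (b : ℕ) : Set

data Ty where
  𝟏    : Ty
  ⊥ₜ   : Ty
  _⊗_  : Ty → Ty → Ty
  _⅋_  : Ty → Ty → Ty
  ⊕⟨_⟩ : TyFam 0 → Ty
  &⟨_⟩ : TyFam 0 → Ty
  &_   : Ty → Ty
  ⊕_   : Ty → Ty

data TyFam b where
  one  : (ℓ : Label) → b ≤ ℓ → Ty → TyFam b
  more : (ℓ : Label) → b ≤ ℓ → Ty → TyFam (suc ℓ) → TyFam b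

dual  : Ty → Ty
dualF : ∀ {b} → TyFam b → TyFam b

dual 𝟏 = ⊥ₜ
dual ⊥ₜ = 𝟏
dual (A ⊗ B) = dual A ⅋ dual B
dual (A ⅋ B) = dual A ⊗ dual B
dual ⊕⟨ F ⟩ = &⟨ dualF F ⟩
dual &⟨ F ⟩ = ⊕⟨ dualF F ⟩
dual (& A) = ⊕ dual A
dual (⊕ A) = & dual A

dualF (one ℓ p A) = one ℓ p (dual A)
dualF (more ℓ p A F) = more ℓ p (dual A) (dualF F)

lookupF : ∀ {b} → TyFam b → Label → Maybe Ty
lookupF (one ℓ _ A) k = if k == ℓ then just A else nothing
lookupF (more ℓ _ A F) k = if k == ℓ then just A else lookupF F k

-- Typing contexts: finite sets of assignments with distinct names,
-- represented as lists (with exchange) whose names are distinct.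

Ctx : Set
Ctx = List (Name × Ty)

dom : Ctx → List Name
dom = map proj₁

WF : Ctx → Set
WF Γ = Unique (dom Γ)

IsAmp : Ty → Set
IsAmp T = ∃[ A ] (T ≡ & A)

AllAmp : Ctx → Set
AllAmp Γ = All (λ a → IsAmp (proj₂ a)) Γ

data _⊢_ : Proc → Ctx → Set
data BrTyped (Γ : Ctx) (x : Name) : {b : ℕ} → Br b → TyFam b → Set

infix 3 _⊢_

data _⊢_ where
  t-exch : ∀ {P Γ Δ} → P ⊢ Γ → Γ ↭ Δ → P ⊢ Δ
  t-cut : ∀ {P Q Γ Δ x A} → WF (Γ ++ Δ) →
    P ⊢ (x , A) ∷ Γ → Q ⊢ (x , dual A) ∷ Δ → nu x P Q ⊢ Γ ++ Δ
  t-mix : ∀ {P Q Γ Δ} → WF (Γ ++ Δ) →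
    P ⊢ Γ → Q ⊢ Δ → (P ∥ Q) ⊢ Γ ++ Δ
  t-choice : ∀ {P Q Γ} → P ⊢ Γ → Q ⊢ Γ → (P ⊞ Q) ⊢ Γ
  t-inact : inact ⊢ []
  t-fwd : ∀ {x y A} → WF ((x , A) ∷ (y , dual A) ∷ []) →
    fwd x y ⊢ (x , A) ∷ (y , dual A) ∷ []
  t-close : ∀ {x} → close x ⊢ (x , 𝟏) ∷ []
  t-wait : ∀ {x P Γ} → WF ((x , ⊥ₜ) ∷ Γ) → P ⊢ Γ → wait x P ⊢ (x , ⊥ₜ) ∷ Γ
  t-out : ∀ {x y P Q Γ Δ A B} → WF ((x , A ⊗ B) ∷ Γ ++ Δ) →
    P ⊢ (y , A) ∷ Γ → Q ⊢ (x , B) ∷ Δ → out x y P Q ⊢ (x , A ⊗ B) ∷ Γ ++ Δ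
  t-inp : ∀ {x y P Γ A B} → WF ((x , A ⅋ B) ∷ Γ) →
    P ⊢ (y , A) ∷ (x , B) ∷ Γ → inp x y P ⊢ (x , A ⅋ B) ∷ Γ
  t-sel : ∀ {x j P Γ F A} → WF ((x , ⊕⟨ F ⟩) ∷ Γ) → lookupF F j ≡ just A →
    P ⊢ (x , A) ∷ Γ → sel x j P ⊢ (x , ⊕⟨ F ⟩) ∷ Γ
  t-bra : ∀ {x bs Γ F} → WF ((x , &⟨ F ⟩) ∷ Γ) →
    BrTyped Γ x bs F → bra x bs ⊢ (x , &⟨ F ⟩) ∷ Γ
  t-avail : ∀ {x P Γ A} → WF ((x , & A) ∷ Γ) →
    P ⊢ (x , A) ∷ Γ → avail x P ⊢ (x , & A) ∷ Γ
  t-unavail : ∀ {x A} → unavail x ⊢ (x , & A) ∷ []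
  t-expect : ∀ {x ws P Γ A} → WF ((x , ⊕ A) ∷ Γ) → AllAmp Γ → ws ↭ dom Γ →
    P ⊢ (x , A) ∷ Γ → expect x ws P ⊢ (x , ⊕ A) ∷ Γ

data BrTyped Γ x where
  bt-one  : ∀ {b ℓ p q P A} → P ⊢ (x , A) ∷ Γ →
            BrTyped Γ x {b} (one ℓ p P) (one ℓ q A)
  bt-more : ∀ {b ℓ p q P A bs F} → P ⊢ (x , A) ∷ Γ → BrTyped Γ x bs F →
            BrTyped Γ x {b} (more ℓ p P bs) (more ℓ q A F)

{-# OPTIONS --safe #-}
-- No rule of ≡ or ⇝ creates or destroys a channel endpoint; the rules only rearrange them, so
-- typing survives. Each axiom of ≡ is checked by inverting the typing derivation up to exchange,
-- and α-conversion by equivariance of typing under swapping a bound name with a fresh one.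
-- For a redex, every branch of a non-deterministic sum carries the whole typing, so each branch
-- C[α;P] is handled on its own: as the subject x of α is not bound by the D-context C, a typing
-- of C[α;P] factors through a typing of α;P in which x keeps its type, the continuation P is
-- typed with what remains, and C can be refilled with it. The precongruence ⪰ and the rule
-- (ν⊞) only discard branches or distribute a context over them.
module Submission where

open import Defs
open import Data.Nat using (ℕ)
open import Data.List using (List; [])
open import Data.Product using (_×_)
open import Relation.Binary.PropositionalEquality using (_≢_)

open import Data.Nat using (_≤_; s≤s) renaming (_≟_ to _≟ℕ_)
import Data.Nat.Properties as ℕ
open import Data.Bool using (true; false)
open import Data.Maybe using (just)
import Data.Maybe as Maybe
open import Data.Product using (∃-syntax; _,_; proj₁; proj₂; zip′) renaming (map to map×)
open import Data.Sum using (_⊎_; inj₁; inj₂; [_,_]′)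
open import Data.Empty using (⊥-elim)
open import Data.List using (_∷_; _++_; map)
import Data.List.Properties as List
open import Data.List.NonEmpty using (List⁺; toList) renaming (map to map⁺)
import Data.List.NonEmpty as List⁺
open import Data.List.Membership.Propositional using (_∈_; _∉_)
open import Data.List.Membership.Propositional.Properties
  using (∈-++⁺ˡ; ∈-++⁺ʳ; ∈-++⁻; ∈-∃++; ∈-map⁺; ∈-map⁻; ∈-filter⁺; ∈-filter⁻)
open import Data.List.Relation.Unary.Any using (here; there)
open import Data.List.Relation.Unary.All using (All; []; _∷_)
open import Data.List.Relation.Unary.All.Properties using (¬Any⇒All¬)
open import Data.List.Relation.Unary.AllPairs using ([]; _∷_)
open import Data.List.Relation.Unary.Unique.Propositional using (Unique)
import Data.List.Relation.Unary.Unique.Propositional.Properties as Unique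
open import Data.List.Relation.Binary.Disjoint.Propositional using (Disjoint)
open import Data.List.Relation.Binary.Subset.Propositional.Properties using () renaming (++⁺ to ⊆-++⁺)
open import Data.List.Relation.Binary.Permutation.Propositional as ↭
  using (_↭_; ↭-refl; ↭-sym; ↭-trans; ↭-prep; ↭⇒↭ₛ)
open import Data.List.Relation.Binary.Permutation.Propositional.Properties
  using (∈-resp-↭; All-resp-↭; ++-comm; shift; drop-∷; ↭-empty-inv; ++⁺ˡ; ++⁺ʳ; ++-commutativeMonoid)
  renaming (map⁺ to ↭-map⁺)
import Data.List.Relation.Binary.Permutation.Setoid.Properties as ↭ₛ
import Algebra.Solver.CommutativeMonoid as CommutativeMonoidSolver
open import Relation.Binary.PropositionalEquality
  using (_≡_; refl; sym; trans; cong; cong₂; subst; subst₂; setoid)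
open import Relation.Nullary using (¬?; yes; no)
open import Relation.Nullary.Decidable using (dec-true; dec-false)
open import Function using (_∘_; id)

Unique-∷⁺ : ∀ {A : Set} {x : A} {xs} → x ∉ xs → Unique xs → Unique (x ∷ xs)
Unique-∷⁺ x∉xs u = ¬Any⇒All¬ _ x∉xs ∷ u

Unique-∷⁻ : ∀ {A : Set} {x : A} {xs} → Unique (x ∷ xs) → x ∉ xs
Unique-∷⁻ = Unique.Unique[x∷xs]⇒x∉xs

Unique-tail : ∀ {A : Set} {x : A} {xs} → Unique (x ∷ xs) → Unique xs
Unique-tail (_ ∷ u) = u

Unique-resp-↭ : ∀ {A : Set} {xs ys : List A} → xs ↭ ys → Unique xs → Unique ys
Unique-resp-↭ {A} p = ↭ₛ.Unique-resp-↭ (setoid A) (↭⇒↭ₛ p)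

Unique-++⁻ˡ : ∀ {A : Set} (xs : List A) {ys} → Unique (xs ++ ys) → Unique xs
Unique-++⁻ˡ [] u = []
Unique-++⁻ˡ (x ∷ xs) u =
  Unique-∷⁺ (Unique-∷⁻ u ∘ ∈-++⁺ˡ) (Unique-++⁻ˡ xs (Unique-tail u))

Unique-++⁻ʳ : ∀ {A : Set} (xs : List A) {ys} → Unique (xs ++ ys) → Unique ys
Unique-++⁻ʳ [] u = u
Unique-++⁻ʳ (x ∷ xs) u = Unique-++⁻ʳ xs (Unique-tail u)

Unique-++⇒Disjoint : ∀ {A : Set} (xs : List A) {ys} → Unique (xs ++ ys) → Disjoint xs ys
Unique-++⇒Disjoint (x ∷ xs) u (here refl , y∈) = Unique-∷⁻ u (∈-++⁺ʳ xs y∈)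
Unique-++⇒Disjoint (x ∷ xs) u (there x∈ , y∈) = Unique-++⇒Disjoint xs (Unique-tail u) (x∈ , y∈)

record InjectiveOn {A B : Set} (σ : A → B) (xs : List A) : Set where
  constructor injectiveOn
  field injective : ∀ {a b} → a ∈ xs → b ∈ xs → σ a ≡ σ b → a ≡ b
open InjectiveOn

InjectiveOn-⊆ : ∀ {A B : Set} {σ : A → B} {xs ys} →
  (∀ {z} → z ∈ ys → z ∈ xs) → InjectiveOn σ xs → InjectiveOn σ ys
InjectiveOn-⊆ ys⊆xs inj = injectiveOn λ a∈ b∈ → injective inj (ys⊆xs a∈) (ys⊆xs b∈)

Unique-map⁺ : ∀ {A B : Set} (σ : A → B) {xs} → InjectiveOn σ xs → Unique xs → Unique (map σ xs)
Unique-map⁺ σ {[]} inj u = []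
Unique-map⁺ σ {x ∷ xs} inj u = Unique-∷⁺ σx∉ (Unique-map⁺ σ (InjectiveOn-⊆ there inj) (Unique-tail u))
  where
  σx∉ : σ x ∉ map σ xs
  σx∉ σx∈ with ∈-map⁻ σ σx∈
  ... | y , y∈ , σx≡σy =
    Unique-∷⁻ u (subst (_∈ xs) (sym (injective inj (here refl) (there y∈) σx≡σy)) y∈)

dom-++ : ∀ (Γ Δ : Ctx) → dom (Γ ++ Δ) ≡ dom Γ ++ dom Δ
dom-++ Γ Δ = List.map-++ proj₁ Γ Δ

∈-dom-++⁻ : ∀ {z} (Γ Δ : Ctx) → z ∈ dom (Γ ++ Δ) → z ∈ dom Γ ⊎ z ∈ dom Δ
∈-dom-++⁻ Γ Δ z∈ = ∈-++⁻ (dom Γ) (subst (_ ∈_) (dom-++ Γ Δ) z∈)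

∈-dom-++⁺ˡ : ∀ {z} (Γ Δ : Ctx) → z ∈ dom Γ → z ∈ dom (Γ ++ Δ)
∈-dom-++⁺ˡ Γ Δ z∈ = subst (_ ∈_) (sym (dom-++ Γ Δ)) (∈-++⁺ˡ z∈)

∈-dom-++⁺ʳ : ∀ {z} (Γ Δ : Ctx) → z ∈ dom Δ → z ∈ dom (Γ ++ Δ)
∈-dom-++⁺ʳ Γ Δ z∈ = subst (_ ∈_) (sym (dom-++ Γ Δ)) (∈-++⁺ʳ (dom Γ) z∈)

∈-dom-resp-↭ : ∀ {z} {Γ Δ : Ctx} → Γ ↭ Δ → z ∈ dom Γ → z ∈ dom Δ
∈-dom-resp-↭ p = ∈-resp-↭ (↭-map⁺ proj₁ p)

∈-dom⇒↭ : ∀ {z} Γ → z ∈ dom Γ → ∃[ T ] ∃[ Γ′ ] (Γ ↭ (z , T) ∷ Γ′)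
∈-dom⇒↭ Γ z∈ with ∈-map⁻ proj₁ z∈
... | (z , T) , z∈Γ , refl with ∈-∃++ z∈Γ
... | us , vs , refl = T , us ++ vs , shift (z , T) us vs

WF-resp-↭ : ∀ {Γ Δ : Ctx} → Γ ↭ Δ → WF Γ → WF Δ
WF-resp-↭ p = Unique-resp-↭ (↭-map⁺ proj₁ p)

WF-++⁻ˡ : ∀ (Γ Δ : Ctx) → WF (Γ ++ Δ) → WF Γ
WF-++⁻ˡ Γ Δ u = Unique-++⁻ˡ (dom Γ) (subst Unique (dom-++ Γ Δ) u)

WF-++⁻ʳ : ∀ (Γ Δ : Ctx) → WF (Γ ++ Δ) → WF Δ
WF-++⁻ʳ Γ Δ u = Unique-++⁻ʳ (dom Γ) (subst Unique (dom-++ Γ Δ) u)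

WF-++⇒Disjoint : ∀ (Γ Δ : Ctx) → WF (Γ ++ Δ) → Disjoint (dom Γ) (dom Δ)
WF-++⇒Disjoint Γ Δ u = Unique-++⇒Disjoint (dom Γ) (subst Unique (dom-++ Γ Δ) u)

WF-++⁺ : ∀ (Γ Δ : Ctx) → WF Γ → WF Δ → Disjoint (dom Γ) (dom Δ) → WF (Γ ++ Δ)
WF-++⁺ Γ Δ u v d = subst Unique (sym (dom-++ Γ Δ)) (Unique.++⁺ u v d)

↭-head-cancel : ∀ {x T T′ Γ Θ} → WF ((x , T′) ∷ Θ) → (x , T) ∷ Γ ↭ (x , T′) ∷ Θ → T ≡ T′ × Γ ↭ Θ
↭-head-cancel w p with ∈-resp-↭ p (here refl)
... | here refl = refl , drop-∷ p
... | there x∈ = ⊥-elim (Unique-∷⁻ w (∈-map⁺ proj₁ x∈))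

↭-extract : ∀ {x A Γ} Γ₁ Γ₂ → (x , A) ∷ Γ ↭ Γ₁ ++ Γ₂ → x ∉ dom Γ₂ →
  ∃[ Γ₁′ ] (Γ₁ ↭ (x , A) ∷ Γ₁′) × (Γ ↭ Γ₁′ ++ Γ₂)
↭-extract {x} {A} Γ₁ Γ₂ p x∉ with ∈-++⁻ Γ₁ (∈-resp-↭ p (here refl))
... | inj₂ x∈ = ⊥-elim (x∉ (∈-map⁺ proj₁ x∈))
... | inj₁ x∈ with ∈-∃++ x∈
...   | us , vs , refl =
  us ++ vs , shift (x , A) us vs , drop-∷ (↭-trans p (++⁺ʳ Γ₂ (shift (x , A) us vs)))

rename : (Name → Name) → Ctx → Ctx
rename σ = map (λ (z , A) → σ z , A)

dom-rename : ∀ σ Γ → dom (rename σ Γ) ≡ map σ (dom Γ)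
dom-rename σ [] = refl
dom-rename σ (_ ∷ Γ) = cong (_ ∷_) (dom-rename σ Γ)

rename-cong-on : ∀ σ τ Γ → (∀ {z} → z ∈ dom Γ → σ z ≡ τ z) → rename σ Γ ≡ rename τ Γ
rename-cong-on σ τ [] eq = refl
rename-cong-on σ τ ((z , A) ∷ Γ) eq =
  cong₂ _∷_ (cong (_, A) (eq (here refl))) (rename-cong-on σ τ Γ (eq ∘ there))

rename-id-on : ∀ σ Γ → (∀ {z} → z ∈ dom Γ → σ z ≡ z) → rename σ Γ ≡ Γ
rename-id-on σ Γ eq = trans (rename-cong-on σ id Γ eq) (List.map-id Γ)

rename-++ : ∀ σ Γ Δ → rename σ (Γ ++ Δ) ≡ rename σ Γ ++ rename σ Δ
rename-++ σ Γ Δ = List.map-++ _ Γ Δ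

WF-rename : ∀ σ Γ → InjectiveOn σ (dom Γ) → WF Γ → WF (rename σ Γ)
WF-rename σ Γ inj u = subst Unique (sym (dom-rename σ Γ)) (Unique-map⁺ σ inj u)

AllAmp-rename : ∀ σ {Γ} → AllAmp Γ → AllAmp (rename σ Γ)
AllAmp-rename σ [] = []
AllAmp-rename σ (a ∷ as) = a ∷ AllAmp-rename σ as

ws↭dom-rename : ∀ σ {ws} Γ → ws ↭ dom Γ → map σ ws ↭ dom (rename σ Γ)
ws↭dom-rename σ Γ p = subst (_ ↭_) (sym (dom-rename σ Γ)) (↭-map⁺ σ p)

module ↭-Solver = CommutativeMonoidSolver (++-commutativeMonoid {A = Name × Ty})
open ↭-Solver using (_⊜_; _⊕_) renaming (solve to ↭-solve)

⊢⇒WF : ∀ {P Γ} → P ⊢ Γ → WF Γ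
⊢⇒WF (t-exch ⊢P p) = WF-resp-↭ p (⊢⇒WF ⊢P)
⊢⇒WF (t-cut w _ _) = w
⊢⇒WF (t-mix w _ _) = w
⊢⇒WF (t-choice ⊢P _) = ⊢⇒WF ⊢P
⊢⇒WF t-inact = []
⊢⇒WF (t-fwd w) = w
⊢⇒WF t-close = [] ∷ []
⊢⇒WF (t-wait w _) = w
⊢⇒WF (t-out w _ _) = w
⊢⇒WF (t-inp w _) = w
⊢⇒WF (t-sel w _ _) = w
⊢⇒WF (t-bra w _) = w
⊢⇒WF (t-avail w _) = w
⊢⇒WF t-unavail = [] ∷ []
⊢⇒WF (t-expect w _ _ _) = w

WF-rename-⊢ : ∀ σ {P Γ} → P ⊢ Γ → InjectiveOn σ (dom Γ) → WF (rename σ Γ)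
WF-rename-⊢ σ {Γ = Γ} ⊢P inj = WF-rename σ Γ inj (⊢⇒WF ⊢P)

⊢-head∉ : ∀ {P x A Γ} → P ⊢ (x , A) ∷ Γ → x ∉ dom Γ
⊢-head∉ ⊢P = Unique-∷⁻ (⊢⇒WF ⊢P)

∈-remove⁺ : ∀ {z y : Name} {xs} → z ∈ xs → z ≢ y → z ∈ remove y xs
∈-remove⁺ {y = y} = ∈-filter⁺ (λ z → ¬? (z ≟ℕ y))

∈-remove⁻ : ∀ {z y : Name} {xs} → z ∈ remove y xs → z ∈ xs × z ≢ y
∈-remove⁻ {y = y} = ∈-filter⁻ (λ z → ¬? (z ≟ℕ y))

dom⊆fn : ∀ {P Γ z} → P ⊢ Γ → z ∈ dom Γ → z ∈ fn P
dom⊆fnB : ∀ {Γ x b} {bs : Br b} {F z} → BrTyped Γ x bs F → z ∈ x ∷ dom Γ → z ∈ fnB bs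
dom⊆fn (t-exch ⊢P p) z∈ = dom⊆fn ⊢P (∈-dom-resp-↭ (↭-sym p) z∈)
dom⊆fn (t-cut {P = P} {Γ = Γ} {Δ} _ ⊢P ⊢Q) z∈ with ∈-dom-++⁻ Γ Δ z∈
... | inj₁ z∈Γ = ∈-remove⁺ (∈-++⁺ˡ (dom⊆fn ⊢P (there z∈Γ))) (λ { refl → ⊢-head∉ ⊢P z∈Γ })
... | inj₂ z∈Δ = ∈-remove⁺ (∈-++⁺ʳ (fn P) (dom⊆fn ⊢Q (there z∈Δ))) (λ { refl → ⊢-head∉ ⊢Q z∈Δ })
dom⊆fn (t-mix {P = P} {Γ = Γ} {Δ} _ ⊢P ⊢Q) z∈ with ∈-dom-++⁻ Γ Δ z∈
... | inj₁ z∈Γ = ∈-++⁺ˡ (dom⊆fn ⊢P z∈Γ)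
... | inj₂ z∈Δ = ∈-++⁺ʳ (fn P) (dom⊆fn ⊢Q z∈Δ)
dom⊆fn (t-choice ⊢P _) z∈ = ∈-++⁺ˡ (dom⊆fn ⊢P z∈)
dom⊆fn (t-fwd _) z∈ = z∈
dom⊆fn t-close z∈ = z∈
dom⊆fn t-unavail z∈ = z∈
dom⊆fn (t-wait _ ⊢P) (here eq) = here eq
dom⊆fn (t-wait _ ⊢P) (there z∈) = there (dom⊆fn ⊢P z∈)
dom⊆fn (t-out _ _ _) (here eq) = here eq
dom⊆fn (t-out {P = P} {Γ = Γ} {Δ} _ ⊢P ⊢Q) (there z∈) with ∈-dom-++⁻ Γ Δ z∈
... | inj₁ z∈Γ = there (∈-++⁺ˡ (∈-remove⁺ (dom⊆fn ⊢P (there z∈Γ)) (λ { refl → ⊢-head∉ ⊢P z∈Γ })))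
... | inj₂ z∈Δ = there (∈-++⁺ʳ (remove _ (fn P)) (dom⊆fn ⊢Q (there z∈Δ)))
dom⊆fn (t-inp _ _) (here eq) = here eq
dom⊆fn (t-inp _ ⊢P) (there z∈) =
  there (∈-remove⁺ (dom⊆fn ⊢P (there (there z∈))) (λ { refl → ⊢-head∉ ⊢P (there z∈) }))
dom⊆fn (t-sel _ _ _) (here eq) = here eq
dom⊆fn (t-sel _ _ ⊢P) (there z∈) = there (dom⊆fn ⊢P (there z∈))
dom⊆fn (t-bra _ _) (here eq) = here eq
dom⊆fn (t-bra _ bt) (there z∈) = there (dom⊆fnB bt (there z∈))
dom⊆fn (t-avail _ _) (here eq) = here eq
dom⊆fn (t-avail _ ⊢P) (there z∈) = there (dom⊆fn ⊢P (there z∈))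
dom⊆fn (t-expect _ _ _ _) (here eq) = here eq
dom⊆fn (t-expect _ _ ws↭ _) (there z∈) = there (∈-++⁺ˡ (∈-resp-↭ (↭-sym ws↭) z∈))
dom⊆fnB (bt-one ⊢P) z∈ = dom⊆fn ⊢P z∈
dom⊆fnB (bt-more ⊢P _) z∈ = ∈-++⁺ˡ (dom⊆fn ⊢P z∈)

∈-tail : ∀ {z x : Name} {xs} → z ≢ x → z ∈ x ∷ xs → z ∈ xs
∈-tail z≢x (here eq) = ⊥-elim (z≢x eq)
∈-tail _ (there z∈) = z∈

fn⊆dom : ∀ {P Γ z} → P ⊢ Γ → z ∈ fn P → z ∈ dom Γ
fn⊆domB : ∀ {Γ x b} {bs : Br b} {F z} → BrTyped Γ x bs F → z ∈ fnB bs → z ∈ x ∷ dom Γ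
fn⊆dom (t-exch ⊢P p) z∈ = ∈-dom-resp-↭ p (fn⊆dom ⊢P z∈)
fn⊆dom (t-cut {P = P} {Γ = Γ} {Δ} _ ⊢P ⊢Q) z∈ with ∈-remove⁻ z∈
... | z∈′ , z≢x with ∈-++⁻ (fn P) z∈′
...   | inj₁ z∈P = ∈-dom-++⁺ˡ Γ Δ (∈-tail z≢x (fn⊆dom ⊢P z∈P))
...   | inj₂ z∈Q = ∈-dom-++⁺ʳ Γ Δ (∈-tail z≢x (fn⊆dom ⊢Q z∈Q))
fn⊆dom (t-mix {P = P} {Γ = Γ} {Δ} _ ⊢P ⊢Q) z∈ with ∈-++⁻ (fn P) z∈
... | inj₁ z∈P = ∈-dom-++⁺ˡ Γ Δ (fn⊆dom ⊢P z∈P)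
... | inj₂ z∈Q = ∈-dom-++⁺ʳ Γ Δ (fn⊆dom ⊢Q z∈Q)
fn⊆dom (t-choice {P = P} ⊢P ⊢Q) z∈ with ∈-++⁻ (fn P) z∈
... | inj₁ z∈P = fn⊆dom ⊢P z∈P
... | inj₂ z∈Q = fn⊆dom ⊢Q z∈Q
fn⊆dom (t-fwd _) z∈ = z∈
fn⊆dom t-close z∈ = z∈
fn⊆dom t-unavail z∈ = z∈
fn⊆dom (t-wait _ _) (here eq) = here eq
fn⊆dom (t-wait _ ⊢P) (there z∈) = there (fn⊆dom ⊢P z∈)
fn⊆dom (t-out _ _ _) (here eq) = here eq
fn⊆dom (t-out {P = P} {Γ = Γ} {Δ} _ ⊢P ⊢Q) (there z∈) with ∈-++⁻ (remove _ (fn P)) z∈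
... | inj₁ z∈P with ∈-remove⁻ z∈P
...   | z∈′ , z≢y = there (∈-dom-++⁺ˡ Γ Δ (∈-tail z≢y (fn⊆dom ⊢P z∈′)))
fn⊆dom (t-out {Γ = Γ} {Δ} _ ⊢P ⊢Q) (there z∈) | inj₂ z∈Q with fn⊆dom ⊢Q z∈Q
...   | here eq = here eq
...   | there z∈Δ = there (∈-dom-++⁺ʳ Γ Δ z∈Δ)
fn⊆dom (t-inp _ _) (here eq) = here eq
fn⊆dom (t-inp _ ⊢P) (there z∈) with ∈-remove⁻ z∈
... | z∈′ , z≢y = ∈-tail z≢y (fn⊆dom ⊢P z∈′)
fn⊆dom (t-sel _ _ _) (here eq) = here eq
fn⊆dom (t-sel _ _ ⊢P) (there z∈) = fn⊆dom ⊢P z∈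
fn⊆dom (t-bra _ _) (here eq) = here eq
fn⊆dom (t-bra _ bt) (there z∈) = fn⊆domB bt z∈
fn⊆dom (t-avail _ _) (here eq) = here eq
fn⊆dom (t-avail _ ⊢P) (there z∈) = fn⊆dom ⊢P z∈
fn⊆dom (t-expect _ _ _ _) (here eq) = here eq
fn⊆dom (t-expect {ws = ws} _ _ ws↭ ⊢P) (there z∈) with ∈-++⁻ ws z∈
... | inj₁ z∈ws = there (∈-resp-↭ ws↭ z∈ws)
... | inj₂ z∈P = fn⊆dom ⊢P z∈P
fn⊆domB (bt-one ⊢P) z∈ = fn⊆dom ⊢P z∈
fn⊆domB (bt-more {P = P} ⊢P bt) z∈ with ∈-++⁻ (fn P) z∈
... | inj₁ z∈P = fn⊆dom ⊢P z∈P
... | inj₂ z∈bs = fn⊆domB bt z∈bs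

fn⊆names : ∀ P {z} → z ∈ fn P → z ∈ names P
fn⊆namesB : ∀ {b} (bs : Br b) {z} → z ∈ fnB bs → z ∈ namesB bs
fn⊆names (fwd x y) z∈ = z∈
fn⊆names (close x) z∈ = z∈
fn⊆names (unavail x) z∈ = z∈
fn⊆names (nu x P Q) z∈ = there (⊆-++⁺ (fn⊆names P) (fn⊆names Q) (proj₁ (∈-remove⁻ z∈)))
fn⊆names (P ⊞ Q) z∈ = ⊆-++⁺ (fn⊆names P) (fn⊆names Q) z∈
fn⊆names (P ∥ Q) z∈ = ⊆-++⁺ (fn⊆names P) (fn⊆names Q) z∈
fn⊆names (out x y P Q) (here eq) = here eq
fn⊆names (out x y P Q) (there z∈) =
  there (there (⊆-++⁺ (fn⊆names P ∘ proj₁ ∘ ∈-remove⁻) (fn⊆names Q) z∈))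
fn⊆names (inp x y P) (here eq) = here eq
fn⊆names (inp x y P) (there z∈) = there (there (fn⊆names P (proj₁ (∈-remove⁻ z∈))))
fn⊆names (sel x ℓ P) (here eq) = here eq
fn⊆names (sel x ℓ P) (there z∈) = there (fn⊆names P z∈)
fn⊆names (bra x bs) (here eq) = here eq
fn⊆names (bra x bs) (there z∈) = there (fn⊆namesB bs z∈)
fn⊆names (wait x P) (here eq) = here eq
fn⊆names (wait x P) (there z∈) = there (fn⊆names P z∈)
fn⊆names (expect x ws P) (here eq) = here eq
fn⊆names (expect x ws P) (there z∈) = there (⊆-++⁺ id (fn⊆names P) z∈)
fn⊆names (avail x P) (here eq) = here eq
fn⊆names (avail x P) (there z∈) = there (fn⊆names P z∈)
fn⊆namesB (one ℓ _ P) z∈ = fn⊆names P z∈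
fn⊆namesB (more ℓ _ P bs) z∈ = ⊆-++⁺ (fn⊆names P) (fn⊆namesB bs) z∈

dom⊆names : ∀ {P Γ z} → P ⊢ Γ → z ∈ dom Γ → z ∈ names P
dom⊆names {P} ⊢P = fn⊆names P ∘ dom⊆fn ⊢P

nu-⊢⁻ : ∀ {x P Q Θ} → nu x P Q ⊢ Θ →
  ∃[ Γ ] ∃[ Δ ] ∃[ A ] (P ⊢ (x , A) ∷ Γ) × (Q ⊢ (x , dual A) ∷ Δ) × (Γ ++ Δ ↭ Θ)
nu-⊢⁻ (t-exch ⊢R p) with nu-⊢⁻ ⊢R
... | Γ , Δ , A , ⊢P , ⊢Q , q = Γ , Δ , A , ⊢P , ⊢Q , ↭-trans q p
nu-⊢⁻ (t-cut _ ⊢P ⊢Q) = _ , _ , _ , ⊢P , ⊢Q , ↭-refl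

par-⊢⁻ : ∀ {P Q Θ} → (P ∥ Q) ⊢ Θ → ∃[ Γ ] ∃[ Δ ] (P ⊢ Γ) × (Q ⊢ Δ) × (Γ ++ Δ ↭ Θ)
par-⊢⁻ (t-exch ⊢R p) with par-⊢⁻ ⊢R
... | Γ , Δ , ⊢P , ⊢Q , q = Γ , Δ , ⊢P , ⊢Q , ↭-trans q p
par-⊢⁻ (t-mix _ ⊢P ⊢Q) = _ , _ , ⊢P , ⊢Q , ↭-refl

choice-⊢⁻ : ∀ {P Q Θ} → (P ⊞ Q) ⊢ Θ → (P ⊢ Θ) × (Q ⊢ Θ)
choice-⊢⁻ (t-exch ⊢R p) with choice-⊢⁻ ⊢R
... | ⊢P , ⊢Q = t-exch ⊢P p , t-exch ⊢Q p
choice-⊢⁻ (t-choice ⊢P ⊢Q) = ⊢P , ⊢Q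

inact-⊢⁻ : ∀ {Θ} → inact ⊢ Θ → Θ ≡ []
inact-⊢⁻ (t-exch ⊢R p) with inact-⊢⁻ ⊢R
... | refl = ↭-empty-inv (↭-sym p)
inact-⊢⁻ t-inact = refl

fwd-⊢⁻ : ∀ {x y Θ} → fwd x y ⊢ Θ → ∃[ A ] ((x , A) ∷ (y , dual A) ∷ [] ↭ Θ)
fwd-⊢⁻ (t-exch ⊢R p) with fwd-⊢⁻ ⊢R
... | A , q = A , ↭-trans q p
fwd-⊢⁻ (t-fwd _) = _ , ↭-refl

close-⊢⁻ : ∀ {x Θ} → close x ⊢ Θ → (x , 𝟏) ∷ [] ↭ Θ
close-⊢⁻ (t-exch ⊢R p) = ↭-trans (close-⊢⁻ ⊢R) p
close-⊢⁻ t-close = ↭-refl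

wait-⊢⁻ : ∀ {x P Θ} → wait x P ⊢ Θ → ∃[ Γ ] (P ⊢ Γ) × ((x , ⊥ₜ) ∷ Γ ↭ Θ)
wait-⊢⁻ (t-exch ⊢R p) with wait-⊢⁻ ⊢R
... | Γ , ⊢P , q = Γ , ⊢P , ↭-trans q p
wait-⊢⁻ (t-wait _ ⊢P) = _ , ⊢P , ↭-refl

out-⊢⁻ : ∀ {x y P Q Θ} → out x y P Q ⊢ Θ →
  ∃[ Γ ] ∃[ Δ ] ∃[ A ] ∃[ B ] (P ⊢ (y , A) ∷ Γ) × (Q ⊢ (x , B) ∷ Δ) × ((x , A ⊗ B) ∷ Γ ++ Δ ↭ Θ)
out-⊢⁻ (t-exch ⊢R p) with out-⊢⁻ ⊢R
... | Γ , Δ , A , B , ⊢P , ⊢Q , q = Γ , Δ , A , B , ⊢P , ⊢Q , ↭-trans q p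
out-⊢⁻ (t-out _ ⊢P ⊢Q) = _ , _ , _ , _ , ⊢P , ⊢Q , ↭-refl

inp-⊢⁻ : ∀ {x y P Θ} → inp x y P ⊢ Θ →
  ∃[ Γ ] ∃[ A ] ∃[ B ] (P ⊢ (y , A) ∷ (x , B) ∷ Γ) × ((x , A ⅋ B) ∷ Γ ↭ Θ)
inp-⊢⁻ (t-exch ⊢R p) with inp-⊢⁻ ⊢R
... | Γ , A , B , ⊢P , q = Γ , A , B , ⊢P , ↭-trans q p
inp-⊢⁻ (t-inp _ ⊢P) = _ , _ , _ , ⊢P , ↭-refl

sel-⊢⁻ : ∀ {x j P Θ} → sel x j P ⊢ Θ →
  ∃[ Γ ] ∃[ F ] ∃[ A ] (lookupF F j ≡ just A) × (P ⊢ (x , A) ∷ Γ) × ((x , ⊕⟨ F ⟩) ∷ Γ ↭ Θ)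
sel-⊢⁻ (t-exch ⊢R p) with sel-⊢⁻ ⊢R
... | Γ , F , A , eq , ⊢P , q = Γ , F , A , eq , ⊢P , ↭-trans q p
sel-⊢⁻ (t-sel _ eq ⊢P) = _ , _ , _ , eq , ⊢P , ↭-refl

bra-⊢⁻ : ∀ {x bs Θ} → bra x bs ⊢ Θ → ∃[ Γ ] ∃[ F ] BrTyped Γ x bs F × ((x , &⟨ F ⟩) ∷ Γ ↭ Θ)
bra-⊢⁻ (t-exch ⊢R p) with bra-⊢⁻ ⊢R
... | Γ , F , bt , q = Γ , F , bt , ↭-trans q p
bra-⊢⁻ (t-bra _ bt) = _ , _ , bt , ↭-refl

avail-⊢⁻ : ∀ {x P Θ} → avail x P ⊢ Θ → ∃[ Γ ] ∃[ A ] (P ⊢ (x , A) ∷ Γ) × ((x , & A) ∷ Γ ↭ Θ)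
avail-⊢⁻ (t-exch ⊢R p) with avail-⊢⁻ ⊢R
... | Γ , A , ⊢P , q = Γ , A , ⊢P , ↭-trans q p
avail-⊢⁻ (t-avail _ ⊢P) = _ , _ , ⊢P , ↭-refl

unavail-⊢⁻ : ∀ {x Θ} → unavail x ⊢ Θ → ∃[ A ] ((x , & A) ∷ [] ↭ Θ)
unavail-⊢⁻ (t-exch ⊢R p) with unavail-⊢⁻ ⊢R
... | A , q = A , ↭-trans q p
unavail-⊢⁻ t-unavail = _ , ↭-refl

expect-⊢⁻ : ∀ {x ws P Θ} → expect x ws P ⊢ Θ →
  ∃[ Γ ] ∃[ A ] AllAmp Γ × (ws ↭ dom Γ) × (P ⊢ (x , A) ∷ Γ) × ((x , ⊕ A) ∷ Γ ↭ Θ)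
expect-⊢⁻ (t-exch ⊢R p) with expect-⊢⁻ ⊢R
... | Γ , A , amp , ws↭ , ⊢P , q = Γ , A , amp , ws↭ , ⊢P , ↭-trans q p
expect-⊢⁻ (t-expect _ amp ws↭ ⊢P) = _ , _ , amp , ws↭ , ⊢P , ↭-refl

↭⊢⇒WF : ∀ {P Γ Θ} → Γ ↭ Θ → P ⊢ Θ → WF Γ
↭⊢⇒WF q ⊢P = WF-resp-↭ (↭-sym q) (⊢⇒WF ⊢P)

cut-↭ : ∀ {x P Q Γ Δ A Θ} → P ⊢ (x , A) ∷ Γ → Q ⊢ (x , dual A) ∷ Δ → WF Θ → Γ ++ Δ ↭ Θ → nu x P Q ⊢ Θ
cut-↭ ⊢P ⊢Q w q = t-exch (t-cut (WF-resp-↭ (↭-sym q) w) ⊢P ⊢Q) q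

mix-↭ : ∀ {P Q Γ Δ Θ} → P ⊢ Γ → Q ⊢ Δ → WF Θ → Γ ++ Δ ↭ Θ → (P ∥ Q) ⊢ Θ
mix-↭ ⊢P ⊢Q w q = t-exch (t-mix (WF-resp-↭ (↭-sym q) w) ⊢P ⊢Q) q

infix 4 _⊢⇒_ _⊢⇔_ _⊢⇒ᵇ_

_⊢⇒_ : Proc → Proc → Set
P ⊢⇒ Q = ∀ {Γ} → P ⊢ Γ → Q ⊢ Γ

_⊢⇔_ : Proc → Proc → Set
P ⊢⇔ Q = (P ⊢⇒ Q) × (Q ⊢⇒ P)

_⊢⇒ᵇ_ : ∀ {c} → Br c → Br c → Set
_⊢⇒ᵇ_ {c} bs bs′ = ∀ {Γ x} {F : TyFam c} → BrTyped Γ x bs F → BrTyped Γ x bs′ F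

⊢⇒-nu : ∀ {x P P′ Q Q′} → P ⊢⇒ P′ → Q ⊢⇒ Q′ → nu x P Q ⊢⇒ nu x P′ Q′
⊢⇒-nu P⇒ Q⇒ ⊢R with nu-⊢⁻ ⊢R
... | _ , _ , _ , ⊢P , ⊢Q , q = cut-↭ (P⇒ ⊢P) (Q⇒ ⊢Q) (⊢⇒WF ⊢R) q

⊢⇒-par : ∀ {P P′ Q Q′} → P ⊢⇒ P′ → Q ⊢⇒ Q′ → (P ∥ Q) ⊢⇒ (P′ ∥ Q′)
⊢⇒-par P⇒ Q⇒ ⊢R with par-⊢⁻ ⊢R
... | _ , _ , ⊢P , ⊢Q , q = mix-↭ (P⇒ ⊢P) (Q⇒ ⊢Q) (⊢⇒WF ⊢R) q

⊢⇒-choice : ∀ {P P′ Q Q′} → P ⊢⇒ P′ → Q ⊢⇒ Q′ → (P ⊞ Q) ⊢⇒ (P′ ⊞ Q′)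
⊢⇒-choice P⇒ Q⇒ ⊢R with choice-⊢⁻ ⊢R
... | ⊢P , ⊢Q = t-choice (P⇒ ⊢P) (Q⇒ ⊢Q)

⊢⇒-out : ∀ {x y P P′ Q Q′} → P ⊢⇒ P′ → Q ⊢⇒ Q′ → out x y P Q ⊢⇒ out x y P′ Q′
⊢⇒-out P⇒ Q⇒ ⊢R with out-⊢⁻ ⊢R
... | _ , _ , _ , _ , ⊢P , ⊢Q , q = t-exch (t-out (↭⊢⇒WF q ⊢R) (P⇒ ⊢P) (Q⇒ ⊢Q)) q

⊢⇒-inp : ∀ {x y P P′} → P ⊢⇒ P′ → inp x y P ⊢⇒ inp x y P′
⊢⇒-inp P⇒ ⊢R with inp-⊢⁻ ⊢R
... | _ , _ , _ , ⊢P , q = t-exch (t-inp (↭⊢⇒WF q ⊢R) (P⇒ ⊢P)) q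

⊢⇒-sel : ∀ {x ℓ P P′} → P ⊢⇒ P′ → sel x ℓ P ⊢⇒ sel x ℓ P′
⊢⇒-sel P⇒ ⊢R with sel-⊢⁻ ⊢R
... | _ , _ , _ , eq , ⊢P , q = t-exch (t-sel (↭⊢⇒WF q ⊢R) eq (P⇒ ⊢P)) q

⊢⇒-bra : ∀ {x bs bs′} → bs ⊢⇒ᵇ bs′ → bra x bs ⊢⇒ bra x bs′
⊢⇒-bra bs⇒ ⊢R with bra-⊢⁻ ⊢R
... | _ , _ , bt , q = t-exch (t-bra (↭⊢⇒WF q ⊢R) (bs⇒ bt)) q

⊢⇒-wait : ∀ {x P P′} → P ⊢⇒ P′ → wait x P ⊢⇒ wait x P′
⊢⇒-wait P⇒ ⊢R with wait-⊢⁻ ⊢R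
... | _ , ⊢P , q = t-exch (t-wait (↭⊢⇒WF q ⊢R) (P⇒ ⊢P)) q

⊢⇒-expect : ∀ {x ws P P′} → P ⊢⇒ P′ → expect x ws P ⊢⇒ expect x ws P′
⊢⇒-expect P⇒ ⊢R with expect-⊢⁻ ⊢R
... | _ , _ , amp , ws↭ , ⊢P , q = t-exch (t-expect (↭⊢⇒WF q ⊢R) amp ws↭ (P⇒ ⊢P)) q

⊢⇒-avail : ∀ {x P P′} → P ⊢⇒ P′ → avail x P ⊢⇒ avail x P′
⊢⇒-avail P⇒ ⊢R with avail-⊢⁻ ⊢R
... | _ , _ , ⊢P , q = t-exch (t-avail (↭⊢⇒WF q ⊢R) (P⇒ ⊢P)) q

⊢⇒ᵇ-one : ∀ {c ℓ p p′ P P′} → P ⊢⇒ P′ → one {c} ℓ p P ⊢⇒ᵇ one ℓ p′ P′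
⊢⇒ᵇ-one P⇒ (bt-one ⊢P) = bt-one (P⇒ ⊢P)

⊢⇒ᵇ-more : ∀ {c ℓ p p′ P P′ bs bs′} → P ⊢⇒ P′ → bs ⊢⇒ᵇ bs′ → more {c} ℓ p P bs ⊢⇒ᵇ more ℓ p′ P′ bs′
⊢⇒ᵇ-more P⇒ bs⇒ (bt-more ⊢P bt) = bt-more (P⇒ ⊢P) (bs⇒ bt)

==-refl : ∀ (a : Name) → (a == a) ≡ true
==-refl a = dec-true (a ≟ℕ a) refl

==-≢ : ∀ {a b : Name} → a ≢ b → (a == b) ≡ false
==-≢ {a} {b} = dec-false (a ≟ℕ b)

swapN-left : ∀ a b → swapN a b a ≡ b
swapN-left a b rewrite ==-refl a = refl

swapN-right : ∀ a b → swapN a b b ≡ a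
swapN-right a b with b ≟ℕ a
... | yes refl = swapN-left b b
... | no b≢a rewrite ==-≢ b≢a | ==-refl b = refl

swapN-other : ∀ {a b z} → z ≢ a → z ≢ b → swapN a b z ≡ z
swapN-other z≢a z≢b rewrite ==-≢ z≢a | ==-≢ z≢b = refl

swapN-involutive : ∀ a b z → swapN a b (swapN a b z) ≡ z
swapN-involutive a b z with z ≟ℕ a
... | yes refl rewrite swapN-left z b = swapN-right z b
... | no z≢a with z ≟ℕ b
...   | yes refl rewrite swapN-right a z = swapN-left a z
...   | no z≢b rewrite swapN-other z≢a z≢b = swapN-other z≢a z≢b

swapN-injective : ∀ a b {u v} → swapN a b u ≡ swapN a b v → u ≡ v
swapN-injective a b {u} {v} eq =
  trans (sym (swapN-involutive a b u)) (trans (cong (swapN a b) eq) (swapN-involutive a b v))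

map-swapN-involutive : ∀ a b xs → map (swapN a b) (map (swapN a b) xs) ≡ xs
map-swapN-involutive a b xs =
  trans (sym (List.map-∘ xs)) (trans (List.map-cong (swapN-involutive a b) xs) (List.map-id xs))

swap-involutive : ∀ a b P → swap a b (swap a b P) ≡ P
swapB-involutive : ∀ a b {c} (bs : Br c) → swapB a b (swapB a b bs) ≡ bs
swap-involutive a b inact = refl
swap-involutive a b (fwd x y) = cong₂ fwd (swapN-involutive a b x) (swapN-involutive a b y)
swap-involutive a b (nu x P Q)
  rewrite swapN-involutive a b x | swap-involutive a b P | swap-involutive a b Q = refl
swap-involutive a b (P ⊞ Q) = cong₂ _⊞_ (swap-involutive a b P) (swap-involutive a b Q)
swap-involutive a b (out x y P Q)
  rewrite swapN-involutive a b x | swapN-involutive a b y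
        | swap-involutive a b P | swap-involutive a b Q = refl
swap-involutive a b (inp x y P)
  rewrite swapN-involutive a b x | swapN-involutive a b y | swap-involutive a b P = refl
swap-involutive a b (sel x ℓ P) rewrite swapN-involutive a b x | swap-involutive a b P = refl
swap-involutive a b (bra x bs) rewrite swapN-involutive a b x | swapB-involutive a b bs = refl
swap-involutive a b (close x) rewrite swapN-involutive a b x = refl
swap-involutive a b (wait x P) rewrite swapN-involutive a b x | swap-involutive a b P = refl
swap-involutive a b (expect x ws P)
  rewrite swapN-involutive a b x | map-swapN-involutive a b ws | swap-involutive a b P = refl
swap-involutive a b (avail x P) rewrite swapN-involutive a b x | swap-involutive a b P = refl
swap-involutive a b (unavail x) rewrite swapN-involutive a b x = refl
swap-involutive a b (P ∥ Q) = cong₂ _∥_ (swap-involutive a b P) (swap-involutive a b Q)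
swapB-involutive a b (one ℓ p P) rewrite swap-involutive a b P = refl
swapB-involutive a b (more ℓ p P bs) rewrite swap-involutive a b P | swapB-involutive a b bs = refl

names-swap : ∀ a b P → names (swap a b P) ≡ map (swapN a b) (names P)
namesB-swap : ∀ a b {c} (bs : Br c) → namesB (swapB a b bs) ≡ map (swapN a b) (namesB bs)
names-swap a b inact = refl
names-swap a b (fwd x y) = refl
names-swap a b (nu x P Q) rewrite names-swap a b P | names-swap a b Q =
  cong (_ ∷_) (sym (List.map-++ _ (names P) (names Q)))
names-swap a b (P ⊞ Q) rewrite names-swap a b P | names-swap a b Q =
  sym (List.map-++ _ (names P) (names Q))
names-swap a b (out x y P Q) rewrite names-swap a b P | names-swap a b Q =
  cong (λ ns → _ ∷ _ ∷ ns) (sym (List.map-++ _ (names P) (names Q)))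
names-swap a b (inp x y P) rewrite names-swap a b P = refl
names-swap a b (sel x ℓ P) rewrite names-swap a b P = refl
names-swap a b (bra x bs) rewrite namesB-swap a b bs = refl
names-swap a b (close x) = refl
names-swap a b (wait x P) rewrite names-swap a b P = refl
names-swap a b (expect x ws P) rewrite names-swap a b P =
  cong (_ ∷_) (sym (List.map-++ _ ws (names P)))
names-swap a b (avail x P) rewrite names-swap a b P = refl
names-swap a b (unavail x) = refl
names-swap a b (P ∥ Q) rewrite names-swap a b P | names-swap a b Q =
  sym (List.map-++ _ (names P) (names Q))
namesB-swap a b (one ℓ p P) = names-swap a b P
namesB-swap a b (more ℓ p P bs) rewrite names-swap a b P | namesB-swap a b bs =
  sym (List.map-++ _ (names P) (namesB bs))

WF-swap-⊢ : ∀ a b {P Γ} → P ⊢ Γ → WF (rename (swapN a b) Γ)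
WF-swap-⊢ a b ⊢P = WF-rename-⊢ (swapN a b) ⊢P (injectiveOn λ _ _ → swapN-injective a b)

swap-⊢ : ∀ a b {P Γ} → P ⊢ Γ → swap a b P ⊢ rename (swapN a b) Γ
swap-BrTyped : ∀ a b {Γ x c} {bs : Br c} {F} → BrTyped Γ x bs F →
  BrTyped (rename (swapN a b) Γ) (swapN a b x) (swapB a b bs) F
swap-⊢ a b (t-exch ⊢P p) = t-exch (swap-⊢ a b ⊢P) (↭-map⁺ _ p)
swap-⊢ a b ⊢S@(t-cut {Γ = Γ} {Δ} _ ⊢P ⊢Q) =
  subst (_ ⊢_) (sym (rename-++ _ Γ Δ))
    (t-cut (subst WF (rename-++ _ Γ Δ) (WF-swap-⊢ a b ⊢S)) (swap-⊢ a b ⊢P) (swap-⊢ a b ⊢Q))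
swap-⊢ a b ⊢S@(t-mix {Γ = Γ} {Δ} _ ⊢P ⊢Q) =
  subst (_ ⊢_) (sym (rename-++ _ Γ Δ))
    (t-mix (subst WF (rename-++ _ Γ Δ) (WF-swap-⊢ a b ⊢S)) (swap-⊢ a b ⊢P) (swap-⊢ a b ⊢Q))
swap-⊢ a b (t-choice ⊢P ⊢Q) = t-choice (swap-⊢ a b ⊢P) (swap-⊢ a b ⊢Q)
swap-⊢ a b t-inact = t-inact
swap-⊢ a b ⊢S@(t-fwd _) = t-fwd (WF-swap-⊢ a b ⊢S)
swap-⊢ a b t-close = t-close
swap-⊢ a b ⊢S@(t-wait _ ⊢P) = t-wait (WF-swap-⊢ a b ⊢S) (swap-⊢ a b ⊢P)
swap-⊢ a b ⊢S@(t-out {x} {Γ = Γ} {Δ} {A} {B} _ ⊢P ⊢Q) =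
  subst (λ Θ → _ ⊢ _ ∷ Θ) (sym (rename-++ _ Γ Δ))
    (t-out (subst (λ Θ → WF ((swapN a b x , A ⊗ B) ∷ Θ)) (rename-++ _ Γ Δ) (WF-swap-⊢ a b ⊢S))
           (swap-⊢ a b ⊢P) (swap-⊢ a b ⊢Q))
swap-⊢ a b ⊢S@(t-inp _ ⊢P) = t-inp (WF-swap-⊢ a b ⊢S) (swap-⊢ a b ⊢P)
swap-⊢ a b ⊢S@(t-sel _ eq ⊢P) = t-sel (WF-swap-⊢ a b ⊢S) eq (swap-⊢ a b ⊢P)
swap-⊢ a b ⊢S@(t-bra _ bt) = t-bra (WF-swap-⊢ a b ⊢S) (swap-BrTyped a b bt)
swap-⊢ a b ⊢S@(t-avail _ ⊢P) = t-avail (WF-swap-⊢ a b ⊢S) (swap-⊢ a b ⊢P)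
swap-⊢ a b t-unavail = t-unavail
swap-⊢ a b ⊢S@(t-expect {Γ = Γ} _ amp ws↭ ⊢P) =
  t-expect (WF-swap-⊢ a b ⊢S) (AllAmp-rename _ amp) (ws↭dom-rename _ Γ ws↭) (swap-⊢ a b ⊢P)
swap-BrTyped a b (bt-one ⊢P) = bt-one (swap-⊢ a b ⊢P)
swap-BrTyped a b (bt-more ⊢P bt) = bt-more (swap-⊢ a b ⊢P) (swap-BrTyped a b bt)

swap-fresh-⊢ : ∀ {y z P A Γ} → z ∉ names P → P ⊢ (y , A) ∷ Γ → swap y z P ⊢ (z , A) ∷ Γ
swap-fresh-⊢ {y} {z} {P} {A} {Γ} z∉ ⊢P =
  subst₂ (λ w Θ → swap y z P ⊢ (w , A) ∷ Θ) (swapN-left y z) Γ-fixed (swap-⊢ y z ⊢P)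
  where
  Γ-fixed : rename (swapN y z) Γ ≡ Γ
  Γ-fixed = rename-id-on _ Γ λ u∈ →
    swapN-other (λ { refl → ⊢-head∉ ⊢P u∈ }) (λ { refl → z∉ (dom⊆names ⊢P (there u∈)) })

swap-fresh-⊢⁻ : ∀ {y z P A Γ} → z ∉ names P → swap y z P ⊢ (z , A) ∷ Γ → P ⊢ (y , A) ∷ Γ
swap-fresh-⊢⁻ {y} {z} {P} {A} {Γ} z∉ ⊢P =
  subst (_⊢ _) (swap-involutive y z P)
    (subst₂ (λ w Θ → swap y z (swap y z P) ⊢ (w , A) ∷ Θ) (swapN-right y z) Γ-fixed (swap-⊢ y z ⊢P))
  where
  y∉Γ : ∀ {u} → u ∈ dom Γ → u ≢ y
  y∉Γ u∈ refl with ∈-map⁻ (swapN y z) (subst (_ ∈_) (names-swap y z P) (dom⊆names ⊢P (there u∈)))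
  ... | k , k∈ , u≡sk =
    z∉ (subst (_∈ names P) (swapN-injective y z (trans (sym u≡sk) (sym (swapN-right y z)))) k∈)
  Γ-fixed : rename (swapN y z) Γ ≡ Γ
  Γ-fixed = rename-id-on _ Γ λ u∈ → swapN-other (y∉Γ u∈) (λ { refl → ⊢-head∉ ⊢P u∈ })

-- α-equivalence and structural congruence

⊢⇒-α-nu : ∀ {x x′ P P′ Q Q′} (z : Name) → z ∉ names (nu x P Q) → z ∉ names (nu x′ P′ Q′) →
  swap x z P ⊢⇒ swap x′ z P′ → swap x z Q ⊢⇒ swap x′ z Q′ → nu x P Q ⊢⇒ nu x′ P′ Q′
⊢⇒-α-nu {P = P} {P′} z z∉ z∉′ P⇒ Q⇒ ⊢R with nu-⊢⁻ ⊢R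
... | _ , _ , _ , ⊢P , ⊢Q , q =
  cut-↭ (swap-fresh-⊢⁻ (z∉′ ∘ there ∘ ∈-++⁺ˡ) (P⇒ (swap-fresh-⊢ (z∉ ∘ there ∘ ∈-++⁺ˡ) ⊢P)))
        (swap-fresh-⊢⁻ (z∉′ ∘ there ∘ ∈-++⁺ʳ (names P′))
                       (Q⇒ (swap-fresh-⊢ (z∉ ∘ there ∘ ∈-++⁺ʳ (names P)) ⊢Q)))
        (⊢⇒WF ⊢R) q

⊢⇒-α-out : ∀ {x y y′ P P′ Q Q′} (z : Name) → z ∉ names (out x y P Q) → z ∉ names (out x y′ P′ Q′) →
  swap y z P ⊢⇒ swap y′ z P′ → Q ⊢⇒ Q′ → out x y P Q ⊢⇒ out x y′ P′ Q′
⊢⇒-α-out z z∉ z∉′ P⇒ Q⇒ ⊢R with out-⊢⁻ ⊢R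
... | _ , _ , _ , _ , ⊢P , ⊢Q , q =
  t-exch (t-out (↭⊢⇒WF q ⊢R)
                (swap-fresh-⊢⁻ (z∉′ ∘ there ∘ there ∘ ∈-++⁺ˡ)
                               (P⇒ (swap-fresh-⊢ (z∉ ∘ there ∘ there ∘ ∈-++⁺ˡ) ⊢P)))
                (Q⇒ ⊢Q))
         q

⊢⇒-α-inp : ∀ {x y y′ P P′} (z : Name) → z ∉ names (inp x y P) → z ∉ names (inp x y′ P′) →
  swap y z P ⊢⇒ swap y′ z P′ → inp x y P ⊢⇒ inp x y′ P′
⊢⇒-α-inp z z∉ z∉′ P⇒ ⊢R with inp-⊢⁻ ⊢R
... | _ , _ , _ , ⊢P , q =
  t-exch (t-inp (↭⊢⇒WF q ⊢R)
                (swap-fresh-⊢⁻ (z∉′ ∘ there ∘ there) (P⇒ (swap-fresh-⊢ (z∉ ∘ there ∘ there) ⊢P))))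
         q

=α⇒⊢⇔ : ∀ {P Q} → P =α Q → P ⊢⇔ Q
=αᵇ⇒⊢⇔ : ∀ {c} {bs bs′ : Br c} → bs =αᵇ bs′ → (bs ⊢⇒ᵇ bs′) × (bs′ ⊢⇒ᵇ bs)
=α⇒⊢⇔ α-inact = id , id
=α⇒⊢⇔ α-fwd = id , id
=α⇒⊢⇔ α-close = id , id
=α⇒⊢⇔ α-unavail = id , id
=α⇒⊢⇔ (α-nu z z∉ z∉′ αP αQ) =
  zip′ (⊢⇒-α-nu z z∉ z∉′) (⊢⇒-α-nu z z∉′ z∉) (=α⇒⊢⇔ αP) (=α⇒⊢⇔ αQ)
=α⇒⊢⇔ (α-out z z∉ z∉′ αP αQ) =
  zip′ (⊢⇒-α-out z z∉ z∉′) (⊢⇒-α-out z z∉′ z∉) (=α⇒⊢⇔ αP) (=α⇒⊢⇔ αQ)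
=α⇒⊢⇔ (α-inp z z∉ z∉′ αP) = map× (⊢⇒-α-inp z z∉ z∉′) (⊢⇒-α-inp z z∉′ z∉) (=α⇒⊢⇔ αP)
=α⇒⊢⇔ (α-choice αP αQ) = zip′ ⊢⇒-choice ⊢⇒-choice (=α⇒⊢⇔ αP) (=α⇒⊢⇔ αQ)
=α⇒⊢⇔ (α-par αP αQ) = zip′ ⊢⇒-par ⊢⇒-par (=α⇒⊢⇔ αP) (=α⇒⊢⇔ αQ)
=α⇒⊢⇔ (α-sel αP) = map× ⊢⇒-sel ⊢⇒-sel (=α⇒⊢⇔ αP)
=α⇒⊢⇔ (α-bra αbs) = map× ⊢⇒-bra ⊢⇒-bra (=αᵇ⇒⊢⇔ αbs)
=α⇒⊢⇔ (α-wait αP) = map× ⊢⇒-wait ⊢⇒-wait (=α⇒⊢⇔ αP)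
=α⇒⊢⇔ (α-expect αP) = map× ⊢⇒-expect ⊢⇒-expect (=α⇒⊢⇔ αP)
=α⇒⊢⇔ (α-avail αP) = map× ⊢⇒-avail ⊢⇒-avail (=α⇒⊢⇔ αP)
=αᵇ⇒⊢⇔ (α-one αP) = map× ⊢⇒ᵇ-one ⊢⇒ᵇ-one (=α⇒⊢⇔ αP)
=αᵇ⇒⊢⇔ (α-more αP αbs) = zip′ ⊢⇒ᵇ-more ⊢⇒ᵇ-more (=α⇒⊢⇔ αP) (=αᵇ⇒⊢⇔ αbs)

dual-involutive : ∀ A → dual (dual A) ≡ A
dualF-involutive : ∀ {b} (F : TyFam b) → dualF (dualF F) ≡ F
dual-involutive 𝟏 = refl
dual-involutive ⊥ₜ = refl
dual-involutive (A ⊗ B) = cong₂ _⊗_ (dual-involutive A) (dual-involutive B)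
dual-involutive (A ⅋ B) = cong₂ _⅋_ (dual-involutive A) (dual-involutive B)
dual-involutive ⊕⟨ F ⟩ = cong ⊕⟨_⟩ (dualF-involutive F)
dual-involutive &⟨ F ⟩ = cong &⟨_⟩ (dualF-involutive F)
dual-involutive (& A) = cong &_ (dual-involutive A)
dual-involutive (⊕ A) = cong ⊕_ (dual-involutive A)
dualF-involutive (one ℓ p A) = cong (one ℓ p) (dual-involutive A)
dualF-involutive (more ℓ p A F) = cong₂ (more ℓ p) (dual-involutive A) (dualF-involutive F)

fwd-sym : ∀ {x y} → fwd x y ⊢⇒ fwd y x
fwd-sym {x} {y} ⊢F with fwd-⊢⁻ ⊢F
... | A , q =
  t-exch (subst (λ T → fwd y x ⊢ (y , dual A) ∷ (x , T) ∷ []) (dual-involutive A)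
                (t-fwd (WF-resp-↭ (↭.swap (x , A) (y , dual A) ↭-refl) (↭⊢⇒WF q ⊢F))))
         (↭-trans (↭.swap _ _ ↭-refl) q)

par-identityʳ : ∀ {P} → (P ∥ inact) ⊢⇔ P
par-identityʳ = elim , intro
  where
  elim : ∀ {P} → (P ∥ inact) ⊢⇒ P
  elim ⊢R with par-⊢⁻ ⊢R
  ... | Γ , _ , ⊢P , ⊢0 , q with inact-⊢⁻ ⊢0
  ... | refl = t-exch ⊢P (subst (_↭ _) (List.++-identityʳ Γ) q)
  intro : ∀ {P} → P ⊢⇒ (P ∥ inact)
  intro {Γ = Γ} ⊢P = mix-↭ ⊢P t-inact (⊢⇒WF ⊢P) (subst (_↭ Γ) (sym (List.++-identityʳ Γ)) ↭-refl)

par-assoc : ∀ {P Q R} → ((P ∥ Q) ∥ R) ⊢⇔ (P ∥ (Q ∥ R))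
par-assoc = to , from
  where
  to : ∀ {P Q R} → ((P ∥ Q) ∥ R) ⊢⇒ (P ∥ (Q ∥ R))
  to ⊢S with par-⊢⁻ ⊢S
  ... | _ , Δ₁ , ⊢PQ , ⊢R , q₁ with par-⊢⁻ ⊢PQ
  ... | Γ₂ , Δ₂ , ⊢P , ⊢Q , q₂ =
    mix-↭ ⊢P (mix-↭ ⊢Q ⊢R (WF-++⁻ʳ Γ₂ _ (↭⊢⇒WF p ⊢S)) ↭-refl) (⊢⇒WF ⊢S) p
    where
    p : Γ₂ ++ (Δ₂ ++ Δ₁) ↭ _
    p = ↭-trans (↭-solve 3 (λ a b c → a ⊕ (b ⊕ c) ⊜ (a ⊕ b) ⊕ c) ↭-refl Γ₂ Δ₂ Δ₁)
                (↭-trans (++⁺ʳ Δ₁ q₂) q₁)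
  from : ∀ {P Q R} → (P ∥ (Q ∥ R)) ⊢⇒ ((P ∥ Q) ∥ R)
  from ⊢S with par-⊢⁻ ⊢S
  ... | Γ₁ , _ , ⊢P , ⊢QR , q₁ with par-⊢⁻ ⊢QR
  ... | Γ₂ , Δ₂ , ⊢Q , ⊢R , q₂ =
    mix-↭ (mix-↭ ⊢P ⊢Q (WF-++⁻ˡ (Γ₁ ++ Γ₂) Δ₂ (↭⊢⇒WF p ⊢S)) ↭-refl) ⊢R (⊢⇒WF ⊢S) p
    where
    p : (Γ₁ ++ Γ₂) ++ Δ₂ ↭ _
    p = ↭-trans (↭-solve 3 (λ a b c → (a ⊕ b) ⊕ c ⊜ a ⊕ (b ⊕ c)) ↭-refl Γ₁ Γ₂ Δ₂)
                (↭-trans (++⁺ˡ Γ₁ q₂) q₁)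

par-comm : ∀ {P Q} → (P ∥ Q) ⊢⇒ (Q ∥ P)
par-comm ⊢R with par-⊢⁻ ⊢R
... | Γ , Δ , ⊢P , ⊢Q , q = mix-↭ ⊢Q ⊢P (⊢⇒WF ⊢R) (↭-trans (++-comm Δ Γ) q)

nu-comm : ∀ {x P Q} → nu x P Q ⊢⇒ nu x Q P
nu-comm {x} {P} ⊢R with nu-⊢⁻ ⊢R
... | Γ , Δ , A , ⊢P , ⊢Q , q =
  cut-↭ ⊢Q (subst (λ T → P ⊢ (x , T) ∷ Γ) (sym (dual-involutive A)) ⊢P)
        (⊢⇒WF ⊢R) (↭-trans (++-comm Δ Γ) q)

choice-idem : ∀ {P} → (P ⊞ P) ⊢⇔ P
choice-idem = proj₁ ∘ choice-⊢⁻ , λ ⊢P → t-choice ⊢P ⊢P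

choice-comm : ∀ {P Q} → (P ⊞ Q) ⊢⇒ (Q ⊞ P)
choice-comm ⊢R = let ⊢P , ⊢Q = choice-⊢⁻ ⊢R in t-choice ⊢Q ⊢P

choice-assoc : ∀ {P Q R} → ((P ⊞ Q) ⊞ R) ⊢⇔ (P ⊞ (Q ⊞ R))
choice-assoc =
  (λ ⊢S → let ⊢PQ , ⊢R = choice-⊢⁻ ⊢S ; ⊢P , ⊢Q = choice-⊢⁻ ⊢PQ in t-choice ⊢P (t-choice ⊢Q ⊢R)) ,
  (λ ⊢S → let ⊢P , ⊢QR = choice-⊢⁻ ⊢S ; ⊢Q , ⊢R = choice-⊢⁻ ⊢QR in t-choice (t-choice ⊢P ⊢Q) ⊢R)

scope-extrusion : ∀ {x P Q R} → x ∉ fn Q → nu x (P ∥ Q) R ⊢⇔ (nu x P R ∥ Q)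
scope-extrusion {x} {P} {Q} {R} x∉ = extrude , intrude
  where
  extrude : nu x (P ∥ Q) R ⊢⇒ (nu x P R ∥ Q)
  extrude ⊢S with nu-⊢⁻ ⊢S
  ... | _ , Δ , _ , ⊢PQ , ⊢R , q with par-⊢⁻ ⊢PQ
  ... | Γ₁ , Γ₂ , ⊢P , ⊢Q , q₂ with ↭-extract Γ₁ Γ₂ (↭-sym q₂) (x∉ ∘ dom⊆fn ⊢Q)
  ... | Γ₁′ , r₁ , r₂ =
    mix-↭ (cut-↭ (t-exch ⊢P r₁) ⊢R (WF-++⁻ˡ (Γ₁′ ++ Δ) Γ₂ (↭⊢⇒WF p ⊢S)) ↭-refl) ⊢Q (⊢⇒WF ⊢S) p
    where
    p : (Γ₁′ ++ Δ) ++ Γ₂ ↭ _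
    p = ↭-trans (↭-solve 3 (λ a b c → (a ⊕ b) ⊕ c ⊜ (a ⊕ c) ⊕ b) ↭-refl Γ₁′ Δ Γ₂)
                (↭-trans (++⁺ʳ Δ (↭-sym r₂)) q)
  intrude : (nu x P R ∥ Q) ⊢⇒ nu x (P ∥ Q) R
  intrude ⊢S with par-⊢⁻ ⊢S
  ... | _ , Θ₂ , ⊢N , ⊢Q , q with nu-⊢⁻ ⊢N
  ... | Γ , Δ , _ , ⊢P , ⊢R , q₁ = cut-↭ (mix-↭ ⊢P ⊢Q (Unique-∷⁺ x∉ΓΘ₂ wΓΘ₂) ↭-refl) ⊢R (⊢⇒WF ⊢S) p
    where
    p : (Γ ++ Θ₂) ++ Δ ↭ _
    p = ↭-trans (↭-solve 3 (λ a b c → (a ⊕ c) ⊕ b ⊜ (a ⊕ b) ⊕ c) ↭-refl Γ Δ Θ₂) (↭-trans (++⁺ʳ Θ₂ q₁) q)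
    wΓΘ₂ : WF (Γ ++ Θ₂)
    wΓΘ₂ = WF-++⁻ˡ (Γ ++ Θ₂) Δ (↭⊢⇒WF p ⊢S)
    x∉ΓΘ₂ : x ∉ dom (Γ ++ Θ₂)
    x∉ΓΘ₂ x∈ = [ ⊢-head∉ ⊢P , x∉ ∘ dom⊆fn ⊢Q ]′ (∈-dom-++⁻ Γ Θ₂ x∈)

nu-nu-comm : ∀ {x y P Q R} → x ∉ fn Q → y ∉ fn R → nu x (nu y P Q) R ⊢⇒ nu y (nu x P R) Q
nu-nu-comm {x} {y} x∉ y∉ ⊢S with nu-⊢⁻ ⊢S
... | _ , Δ , _ , ⊢N , ⊢R , q with nu-⊢⁻ ⊢N
... | Γ₁ , Γ₂ , _ , ⊢P , ⊢Q , q₂ with ↭-extract Γ₁ Γ₂ (↭-sym q₂) (x∉ ∘ dom⊆fn ⊢Q ∘ there)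
... | Γ₁′ , r₁ , r₂ =
  cut-↭ (t-cut (Unique-∷⁺ y∉Γ₁′Δ wΓ₁′Δ) (t-exch ⊢P (↭-trans (↭-prep _ r₁) (↭.swap _ _ ↭-refl))) ⊢R)
        ⊢Q (⊢⇒WF ⊢S) p
  where
  p : (Γ₁′ ++ Δ) ++ Γ₂ ↭ _
  p = ↭-trans (↭-solve 3 (λ a b c → (a ⊕ b) ⊕ c ⊜ (a ⊕ c) ⊕ b) ↭-refl Γ₁′ Δ Γ₂)
              (↭-trans (++⁺ʳ Δ (↭-sym r₂)) q)
  wΓ₁′Δ : WF (Γ₁′ ++ Δ)
  wΓ₁′Δ = WF-++⁻ˡ (Γ₁′ ++ Δ) Γ₂ (↭⊢⇒WF p ⊢S)
  y∉Γ₁′Δ : y ∉ dom (Γ₁′ ++ Δ)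
  y∉Γ₁′Δ y∈ = [ ⊢-head∉ ⊢P ∘ ∈-dom-resp-↭ (↭-sym r₁) ∘ there , y∉ ∘ dom⊆fn ⊢R ∘ there ]′
                (∈-dom-++⁻ Γ₁′ Δ y∈)

≡ₛ⇒⊢⇔ : ∀ {P Q} → P ≡ₛ Q → P ⊢⇔ Q
≡ₛᵇ⇒⊢⇔ : ∀ {c} {bs bs′ : Br c} → bs ≡ₛᵇ bs′ → (bs ⊢⇒ᵇ bs′) × (bs′ ⊢⇒ᵇ bs)
≡ₛ⇒⊢⇔ s-refl = id , id
≡ₛ⇒⊢⇔ (s-sym e) = let to , from = ≡ₛ⇒⊢⇔ e in from , to
≡ₛ⇒⊢⇔ (s-trans e₁ e₂) =
  let to₁ , from₁ = ≡ₛ⇒⊢⇔ e₁ ; to₂ , from₂ = ≡ₛ⇒⊢⇔ e₂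
  in (λ ⊢P → to₂ (to₁ ⊢P)) , (λ ⊢R → from₁ (from₂ ⊢R))
≡ₛ⇒⊢⇔ (c-nu e₁ e₂) = zip′ ⊢⇒-nu ⊢⇒-nu (≡ₛ⇒⊢⇔ e₁) (≡ₛ⇒⊢⇔ e₂)
≡ₛ⇒⊢⇔ (c-choice e₁ e₂) = zip′ ⊢⇒-choice ⊢⇒-choice (≡ₛ⇒⊢⇔ e₁) (≡ₛ⇒⊢⇔ e₂)
≡ₛ⇒⊢⇔ (c-out e₁ e₂) = zip′ ⊢⇒-out ⊢⇒-out (≡ₛ⇒⊢⇔ e₁) (≡ₛ⇒⊢⇔ e₂)
≡ₛ⇒⊢⇔ (c-par e₁ e₂) = zip′ ⊢⇒-par ⊢⇒-par (≡ₛ⇒⊢⇔ e₁) (≡ₛ⇒⊢⇔ e₂)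
≡ₛ⇒⊢⇔ (c-inp e) = map× ⊢⇒-inp ⊢⇒-inp (≡ₛ⇒⊢⇔ e)
≡ₛ⇒⊢⇔ (c-sel e) = map× ⊢⇒-sel ⊢⇒-sel (≡ₛ⇒⊢⇔ e)
≡ₛ⇒⊢⇔ (c-bra e) = map× ⊢⇒-bra ⊢⇒-bra (≡ₛᵇ⇒⊢⇔ e)
≡ₛ⇒⊢⇔ (c-wait e) = map× ⊢⇒-wait ⊢⇒-wait (≡ₛ⇒⊢⇔ e)
≡ₛ⇒⊢⇔ (c-expect e) = map× ⊢⇒-expect ⊢⇒-expect (≡ₛ⇒⊢⇔ e)
≡ₛ⇒⊢⇔ (c-avail e) = map× ⊢⇒-avail ⊢⇒-avail (≡ₛ⇒⊢⇔ e)
≡ₛ⇒⊢⇔ (s-alpha α) = =α⇒⊢⇔ α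
≡ₛ⇒⊢⇔ s-fwd = fwd-sym , fwd-sym
≡ₛ⇒⊢⇔ s-par-unit = par-identityʳ
≡ₛ⇒⊢⇔ s-par-assoc = par-assoc
≡ₛ⇒⊢⇔ s-par-comm = par-comm , par-comm
≡ₛ⇒⊢⇔ s-nu-comm = nu-comm , nu-comm
≡ₛ⇒⊢⇔ s-ch-idem = choice-idem
≡ₛ⇒⊢⇔ s-ch-comm = choice-comm , choice-comm
≡ₛ⇒⊢⇔ s-ch-assoc = choice-assoc
≡ₛ⇒⊢⇔ (s-scope x∉) = scope-extrusion x∉
≡ₛ⇒⊢⇔ (s-nu-nu x∉ y∉) = nu-nu-comm x∉ y∉ , nu-nu-comm y∉ x∉
≡ₛᵇ⇒⊢⇔ (c-one e) = map× ⊢⇒ᵇ-one ⊢⇒ᵇ-one (≡ₛ⇒⊢⇔ e)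
≡ₛᵇ⇒⊢⇔ (c-more e es) = zip′ ⊢⇒ᵇ-more ⊢⇒ᵇ-more (≡ₛ⇒⊢⇔ e) (≡ₛᵇ⇒⊢⇔ es)

-- Renaming and substitution

∈⇒≤maxL : ∀ {n} xs → n ∈ xs → n ≤ maxL xs
∈⇒≤maxL (x ∷ xs) (here refl) = ℕ.m≤m⊔n x (maxL xs)
∈⇒≤maxL (x ∷ xs) (there n∈) = ℕ.≤-trans (∈⇒≤maxL xs n∈) (ℕ.m≤n⊔m x (maxL xs))

freshFor-fresh : ∀ σ R {z} → z ∈ names R → σ z ≢ freshFor σ R
freshFor-fresh σ R z∈ = ℕ.<⇒≢ (s≤s (∈⇒≤maxL (map σ (names R)) (∈-map⁺ σ z∈)))

update-hit : ∀ σ x w → (σ [ x ↦ w ]) x ≡ w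
update-hit σ x w rewrite ==-refl x = refl

update-miss : ∀ σ x w {z} → z ≢ x → (σ [ x ↦ w ]) z ≡ σ z
update-miss σ x w z≢x rewrite ==-≢ z≢x = refl

rename-update : ∀ σ x w A Γ → x ∉ dom Γ → rename (σ [ x ↦ w ]) ((x , A) ∷ Γ) ≡ (w , A) ∷ rename σ Γ
rename-update σ x w A Γ x∉ = cong₂ _∷_ (cong (_, A) (update-hit σ x w))
  (rename-cong-on _ σ Γ λ z∈ → update-miss σ x w (λ { refl → x∉ z∈ }))

InjectiveOn-update : ∀ {σ xs x w} → InjectiveOn σ xs → (∀ {b} → b ∈ xs → σ b ≢ w) → x ∉ xs →
  InjectiveOn (σ [ x ↦ w ]) (x ∷ xs)
InjectiveOn-update {σ} {xs} {x} {w} inj w-fresh x∉ = injectiveOn σ′-injective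
  where
  σ′-miss : ∀ {b} → b ∈ xs → (σ [ x ↦ w ]) b ≡ σ b
  σ′-miss b∈ = update-miss σ x w (λ { refl → x∉ b∈ })
  σ′-injective : ∀ {a b} → a ∈ x ∷ xs → b ∈ x ∷ xs → (σ [ x ↦ w ]) a ≡ (σ [ x ↦ w ]) b → a ≡ b
  σ′-injective (here refl) (here refl) eq = refl
  σ′-injective (here refl) (there b∈) eq =
    ⊥-elim (w-fresh b∈ (trans (sym (σ′-miss b∈)) (trans (sym eq) (update-hit σ x w))))
  σ′-injective (there a∈) (here refl) eq =
    ⊥-elim (w-fresh a∈ (trans (sym (σ′-miss a∈)) (trans eq (update-hit σ x w))))
  σ′-injective (there a∈) (there b∈) eq =
    injective inj a∈ b∈ (trans (sym (σ′-miss a∈)) (trans eq (σ′-miss b∈)))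

ren-⊢ : ∀ σ {P Γ} → P ⊢ Γ → InjectiveOn σ (dom Γ) → ren σ P ⊢ rename σ Γ
ren-BrTyped : ∀ σ {Γ x c} {bs : Br c} {F} → BrTyped Γ x bs F → InjectiveOn σ (x ∷ dom Γ) →
  BrTyped (rename σ Γ) (σ x) (renB σ bs) F
ren-binder : ∀ σ R {P x A Γ} → P ⊢ (x , A) ∷ Γ → InjectiveOn σ (dom Γ) →
  (∀ {z} → z ∈ names P → z ∈ names R) →
  ren (σ [ x ↦ freshFor σ R ]) P ⊢ (freshFor σ R , A) ∷ rename σ Γ
ren-⊢ σ (t-exch ⊢P p) inj = t-exch (ren-⊢ σ ⊢P (InjectiveOn-⊆ (∈-dom-resp-↭ p) inj)) (↭-map⁺ _ p)
ren-⊢ σ ⊢S@(t-cut {P = P} {Q} {Γ} {Δ} {x} _ ⊢P ⊢Q) inj =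
  subst (_ ⊢_) (sym (rename-++ σ Γ Δ))
    (t-cut (subst WF (rename-++ σ Γ Δ) (WF-rename-⊢ σ ⊢S inj))
      (ren-binder σ (nu x P Q) ⊢P (InjectiveOn-⊆ (∈-dom-++⁺ˡ Γ Δ) inj) (there ∘ ∈-++⁺ˡ))
      (ren-binder σ (nu x P Q) ⊢Q (InjectiveOn-⊆ (∈-dom-++⁺ʳ Γ Δ) inj) (there ∘ ∈-++⁺ʳ (names P))))
ren-⊢ σ ⊢S@(t-mix {Γ = Γ} {Δ} _ ⊢P ⊢Q) inj =
  subst (_ ⊢_) (sym (rename-++ σ Γ Δ))
    (t-mix (subst WF (rename-++ σ Γ Δ) (WF-rename-⊢ σ ⊢S inj))
      (ren-⊢ σ ⊢P (InjectiveOn-⊆ (∈-dom-++⁺ˡ Γ Δ) inj))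
      (ren-⊢ σ ⊢Q (InjectiveOn-⊆ (∈-dom-++⁺ʳ Γ Δ) inj)))
ren-⊢ σ (t-choice ⊢P ⊢Q) inj = t-choice (ren-⊢ σ ⊢P inj) (ren-⊢ σ ⊢Q inj)
ren-⊢ σ t-inact inj = t-inact
ren-⊢ σ ⊢S@(t-fwd _) inj = t-fwd (WF-rename-⊢ σ ⊢S inj)
ren-⊢ σ t-close inj = t-close
ren-⊢ σ ⊢S@(t-wait _ ⊢P) inj = t-wait (WF-rename-⊢ σ ⊢S inj) (ren-⊢ σ ⊢P (InjectiveOn-⊆ there inj))
ren-⊢ σ ⊢S@(t-out {x} {y} {P} {Q} {Γ} {Δ} {A} {B} _ ⊢P ⊢Q) inj =
  subst (λ Θ → _ ⊢ (σ x , A ⊗ B) ∷ Θ) (sym (rename-++ σ Γ Δ))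
    (t-out (subst (λ Θ → WF ((σ x , A ⊗ B) ∷ Θ)) (rename-++ σ Γ Δ) (WF-rename-⊢ σ ⊢S inj))
      (ren-binder σ P ⊢P (InjectiveOn-⊆ (there ∘ ∈-dom-++⁺ˡ Γ Δ) inj) id)
      (ren-⊢ σ ⊢Q (InjectiveOn-⊆ (λ { (here eq) → here eq ; (there z∈) → there (∈-dom-++⁺ʳ Γ Δ z∈) })
                                 inj)))
ren-⊢ σ ⊢S@(t-inp {P = P} _ ⊢P) inj = t-inp (WF-rename-⊢ σ ⊢S inj) (ren-binder σ P ⊢P inj id)
ren-⊢ σ ⊢S@(t-sel _ eq ⊢P) inj = t-sel (WF-rename-⊢ σ ⊢S inj) eq (ren-⊢ σ ⊢P inj)
ren-⊢ σ ⊢S@(t-bra _ bt) inj = t-bra (WF-rename-⊢ σ ⊢S inj) (ren-BrTyped σ bt inj)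
ren-⊢ σ ⊢S@(t-avail _ ⊢P) inj = t-avail (WF-rename-⊢ σ ⊢S inj) (ren-⊢ σ ⊢P inj)
ren-⊢ σ t-unavail inj = t-unavail
ren-⊢ σ ⊢S@(t-expect {Γ = Γ} _ amp ws↭ ⊢P) inj =
  t-expect (WF-rename-⊢ σ ⊢S inj) (AllAmp-rename σ amp) (ws↭dom-rename σ Γ ws↭) (ren-⊢ σ ⊢P inj)
ren-BrTyped σ (bt-one ⊢P) inj = bt-one (ren-⊢ σ ⊢P inj)
ren-BrTyped σ (bt-more ⊢P bt) inj = bt-more (ren-⊢ σ ⊢P inj) (ren-BrTyped σ bt inj)
ren-binder σ R {P} {x} {A} {Γ} ⊢P inj P⊆R =
  subst (ren (σ [ x ↦ freshFor σ R ]) P ⊢_) (rename-update σ x _ A Γ (⊢-head∉ ⊢P))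
    (ren-⊢ _ ⊢P (InjectiveOn-update inj (λ b∈ → freshFor-fresh σ R (P⊆R (dom⊆names ⊢P (there b∈))))
                                        (⊢-head∉ ⊢P)))

subst-⊢ : ∀ {P x y A Γ} → P ⊢ (x , A) ∷ Γ → y ∉ dom Γ → P [ y / x ] ⊢ (y , A) ∷ Γ
subst-⊢ {P} {x} {y} {A} {Γ} ⊢P y∉ =
  subst (P [ y / x ] ⊢_)
    (trans (rename-update id x y A Γ (⊢-head∉ ⊢P)) (cong (_ ∷_) (rename-id-on id Γ λ _ → refl)))
    (ren-⊢ (id [ x ↦ y ]) ⊢P
      (InjectiveOn-update (injectiveOn λ _ _ eq → eq) (λ { b∈ refl → y∉ b∈ }) (⊢-head∉ ⊢P)))

-- Typing D-contexts

↭-exchange-heads : ∀ {v x A T Θ₁ Θ₂} → v ≢ x → (v , A) ∷ Θ₁ ↭ (x , T) ∷ Θ₂ →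
  ∃[ Θ ] (Θ₁ ↭ (x , T) ∷ Θ) × (Θ₂ ↭ (v , A) ∷ Θ)
↭-exchange-heads {x = x} {T = T} {Θ₂ = Θ₂} v≢x p
  with ↭-extract Θ₂ ((x , T) ∷ []) (↭-trans p (++-comm ((x , T) ∷ []) Θ₂)) (λ { (here eq) → v≢x eq })
... | Θ , r₁ , r₂ = Θ , ↭-trans r₂ (++-comm Θ ((x , T) ∷ [])) , r₁

-- CtxTyping C Φ Θ : C turns a process typed Φ into one typed Θ
data CtxTyping : DCtx → Ctx → Ctx → Set where
  ct-hole : ∀ {Φ Θ} → Φ ↭ Θ → WF Θ → CtxTyping hole Φ Θ
  ct-par : ∀ {C R Φ Θ₁ Θ₂ Θ} → CtxTyping C Φ Θ₁ → R ⊢ Θ₂ → Θ₁ ++ Θ₂ ↭ Θ → WF Θ →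
    CtxTyping (C ∥ₙ R) Φ Θ
  ct-nu : ∀ {v C R Φ A Θ₁ Θ₂ Θ} → CtxTyping C Φ ((v , A) ∷ Θ₁) → R ⊢ (v , dual A) ∷ Θ₂ →
    Θ₁ ++ Θ₂ ↭ Θ → WF Θ → CtxTyping (nuₙ v C R) Φ Θ

CtxTyping⇒WF : ∀ {C Φ Θ} → CtxTyping C Φ Θ → WF Θ
CtxTyping⇒WF (ct-hole _ w) = w
CtxTyping⇒WF (ct-par _ _ _ w) = w
CtxTyping⇒WF (ct-nu _ _ _ w) = w

plug-⊢⁻ : ∀ C {X Θ} → plug C X ⊢ Θ → ∃[ Φ ] (X ⊢ Φ) × CtxTyping C Φ Θ
plug-⊢⁻ hole ⊢X = _ , ⊢X , ct-hole ↭-refl (⊢⇒WF ⊢X)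
plug-⊢⁻ (C ∥ₙ R) ⊢S with par-⊢⁻ ⊢S
... | _ , _ , ⊢CX , ⊢R , q with plug-⊢⁻ C ⊢CX
... | Φ , ⊢X , ct = Φ , ⊢X , ct-par ct ⊢R q (⊢⇒WF ⊢S)
plug-⊢⁻ (nuₙ v C R) ⊢S with nu-⊢⁻ ⊢S
... | _ , _ , _ , ⊢CX , ⊢R , q with plug-⊢⁻ C ⊢CX
... | Φ , ⊢X , ct = Φ , ⊢X , ct-nu ct ⊢R q (⊢⇒WF ⊢S)

plug-⊢⁺ : ∀ {C Φ Θ Y} → CtxTyping C Φ Θ → Y ⊢ Φ → plug C Y ⊢ Θ
plug-⊢⁺ (ct-hole q _) ⊢Y = t-exch ⊢Y q
plug-⊢⁺ (ct-par ct ⊢R q w) ⊢Y = mix-↭ (plug-⊢⁺ ct ⊢Y) ⊢R w q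
plug-⊢⁺ (ct-nu ct ⊢R q w) ⊢Y = cut-↭ (plug-⊢⁺ ct ⊢Y) ⊢R w q

CtxTyping-resp-↭ʳ : ∀ {C Φ Θ Θ′} → CtxTyping C Φ Θ → Θ ↭ Θ′ → CtxTyping C Φ Θ′
CtxTyping-resp-↭ʳ (ct-hole q w) p = ct-hole (↭-trans q p) (WF-resp-↭ p w)
CtxTyping-resp-↭ʳ (ct-par ct ⊢R q w) p = ct-par ct ⊢R (↭-trans q p) (WF-resp-↭ p w)
CtxTyping-resp-↭ʳ (ct-nu ct ⊢R q w) p = ct-nu ct ⊢R (↭-trans q p) (WF-resp-↭ p w)

CtxTyping-resp-↭ˡ : ∀ {C Φ Φ′ Θ} → CtxTyping C Φ Θ → Φ′ ↭ Φ → CtxTyping C Φ′ Θ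
CtxTyping-resp-↭ˡ (ct-hole q w) p = ct-hole (↭-trans p q) w
CtxTyping-resp-↭ˡ (ct-par ct ⊢R q w) p = ct-par (CtxTyping-resp-↭ˡ ct p) ⊢R q w
CtxTyping-resp-↭ˡ (ct-nu ct ⊢R q w) p = ct-nu (CtxTyping-resp-↭ˡ ct p) ⊢R q w

hole-dom⊆ : ∀ {C Φ Θ z} → CtxTyping C Φ Θ → z ∈ dom Φ → z ∈ dom Θ ⊎ z ∈ bv C
hole-dom⊆ (ct-hole q _) z∈ = inj₁ (∈-dom-resp-↭ q z∈)
hole-dom⊆ (ct-par {Θ₁ = Θ₁} {Θ₂} ct _ q _) z∈ with hole-dom⊆ ct z∈
... | inj₁ z∈Θ₁ = inj₁ (∈-dom-resp-↭ q (∈-dom-++⁺ˡ Θ₁ Θ₂ z∈Θ₁))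
... | inj₂ z∈bv = inj₂ z∈bv
hole-dom⊆ (ct-nu {Θ₁ = Θ₁} {Θ₂} ct _ q _) z∈ with hole-dom⊆ ct z∈
... | inj₁ (here eq) = inj₂ (here eq)
... | inj₁ (there z∈Θ₁) = inj₁ (∈-dom-resp-↭ q (∈-dom-++⁺ˡ Θ₁ Θ₂ z∈Θ₁))
... | inj₂ z∈bv = inj₂ (there z∈bv)

Refillable : DCtx → Ctx → Ctx → Set
Refillable C Φ Θ = ∀ Ψ → Avoids C (dom Ψ) → WF (Ψ ++ Θ) → CtxTyping C (Ψ ++ Φ) (Ψ ++ Θ)

-- A name typed in the hole and not bound by C passes through C unchanged, and may be
-- replaced by any context Ψ avoiding the binders of C.
frame : ∀ {C x T Φ Θ} → CtxTyping C ((x , T) ∷ Φ) Θ → x ∉ bv C →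
  ∃[ Θ′ ] (Θ ↭ (x , T) ∷ Θ′) × Refillable C Φ Θ′
frame {Φ = Φ} (ct-hole q _) _ = Φ , ↭-sym q , λ Ψ _ w → ct-hole ↭-refl w
frame (ct-par {Θ₂ = Θ₂} ct ⊢R q _) x∉ with frame ct x∉
... | Θ′ , r , refill = Θ′ ++ Θ₂ , ↭-trans (↭-sym q) (++⁺ʳ Θ₂ r) , refill′
  where
  refill′ : Refillable (_ ∥ₙ _) _ (Θ′ ++ Θ₂)
  refill′ Ψ av w = ct-par (refill Ψ av (WF-++⁻ˡ (Ψ ++ Θ′) Θ₂ (WF-resp-↭ (↭-sym assoc) w))) ⊢R assoc w
    where
    assoc : (Ψ ++ Θ′) ++ Θ₂ ↭ Ψ ++ Θ′ ++ Θ₂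
    assoc = ↭.↭-reflexive (List.++-assoc Ψ Θ′ Θ₂)
frame (ct-nu {v} {A = A} {Θ₂ = Θ₂} ct ⊢R q _) x∉ with frame ct (x∉ ∘ there)
... | Θ₁′ , r , refill with ↭-exchange-heads (λ { refl → x∉ (here refl) }) r
... | Θ′ , r₁ , r₂ = Θ′ ++ Θ₂ , ↭-trans (↭-sym q) (++⁺ʳ Θ₂ r₁) , refill′
  where
  refill′ : Refillable (nuₙ v _ _) _ (Θ′ ++ Θ₂)
  refill′ Ψ av w = ct-nu (CtxTyping-resp-↭ʳ (refill Ψ (av ∘ there) wΨΘ₁′) pv) ⊢R assoc w
    where
    assoc : (Ψ ++ Θ′) ++ Θ₂ ↭ Ψ ++ Θ′ ++ Θ₂
    assoc = ↭.↭-reflexive (List.++-assoc Ψ Θ′ Θ₂)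
    pv : Ψ ++ Θ₁′ ↭ (v , A) ∷ (Ψ ++ Θ′)
    pv = ↭-trans (++⁺ˡ Ψ r₂) (shift (v , A) Ψ Θ′)
    v∉ΨΘ′ : v ∉ dom (Ψ ++ Θ′)
    v∉ΨΘ′ v∈ = [ av (here refl) , Unique-∷⁻ (CtxTyping⇒WF ct) ∘ ∈-dom-resp-↭ (↭-sym r₁) ∘ there ]′
                 (∈-dom-++⁻ Ψ Θ′ v∈)
    wΨΘ₁′ : WF (Ψ ++ Θ₁′)
    wΨΘ₁′ = WF-resp-↭ (↭-sym pv) (Unique-∷⁺ v∉ΨΘ′ (WF-++⁻ˡ (Ψ ++ Θ′) Θ₂ (WF-resp-↭ (↭-sym assoc) w)))

record Focus (C : DCtx) (X : Proc) (x : Name) (T : Ty) (Γ : Ctx) : Set where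
  constructor focused
  field
    residual : Ctx
    hole-⊢ : X ⊢ (x , T) ∷ residual
    WF-refill : ∀ Ψ → Avoids C (dom Ψ) → WF (Ψ ++ Γ) → WF (Ψ ++ residual)
    refill : ∀ Ψ {Y} → Avoids C (dom Ψ) → WF (Ψ ++ Γ) → Y ⊢ Ψ ++ residual → plug C Y ⊢ Ψ ++ Γ

focus : ∀ C {X x T Γ} → x ∈ fn X → plug C X ⊢ (x , T) ∷ Γ → x ∉ bv C → Focus C X x T Γ
focus C {X} {x} {T} {Γ} x∈X ⊢CX x∉ with plug-⊢⁻ C ⊢CX
... | Φ , ⊢X , ct with ∈-dom⇒↭ Φ (fn⊆dom ⊢X x∈X)
... | T′ , Φ′ , pΦ with frame (CtxTyping-resp-↭ˡ ct (↭-sym pΦ)) x∉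
... | Θ′ , r , refill with ↭-head-cancel (WF-resp-↭ r (CtxTyping⇒WF ct)) r
... | refl , Γ↭Θ′ = record
  { residual = Φ′
  ; hole-⊢ = ⊢X′
  ; WF-refill = WF-refill
  ; refill = λ Ψ av w ⊢Y →
      t-exch (plug-⊢⁺ (refill Ψ av (WF-resp-↭ (++⁺ˡ Ψ Γ↭Θ′) w)) ⊢Y) (++⁺ˡ Ψ (↭-sym Γ↭Θ′))
  }
  where
  ⊢X′ : X ⊢ (x , T) ∷ Φ′
  ⊢X′ = t-exch ⊢X pΦ
  WF-refill : ∀ Ψ → Avoids C (dom Ψ) → WF (Ψ ++ Γ) → WF (Ψ ++ Φ′)
  WF-refill Ψ av w = WF-++⁺ Ψ Φ′ (WF-++⁻ˡ Ψ Γ w) (Unique-tail (⊢⇒WF ⊢X′)) disjoint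
    where
    disjoint : Disjoint (dom Ψ) (dom Φ′)
    disjoint (z∈Ψ , z∈Φ′) with hole-dom⊆ (CtxTyping-resp-↭ˡ ct (↭-sym pΦ)) (there z∈Φ′)
    ... | inj₁ (here refl) = ⊢-head∉ ⊢X′ z∈Φ′
    ... | inj₁ (there z∈Γ) = WF-++⇒Disjoint Ψ Γ w (z∈Ψ , z∈Γ)
    ... | inj₂ z∈bv = av z∈bv z∈Ψ

no-binders : ∀ C → Avoids C (dom [])
no-binders C _ ()

fresh-binder : ∀ C {x} → x ∉ bv C → Avoids C (x ∷ [])
fresh-binder C x∉ z∈bv (here refl) = x∉ z∈bv

⨁ : ∀ {I : Set} → (I → Proc) → List⁺ I → Proc
⨁ f L = ⊞⁺ (map⁺ f L)

Branches : ∀ {I : Set} → (I → Proc) → List⁺ I → Ctx → Set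
Branches f L Θ = ∀ {c} → c ∈ toList L → f c ⊢ Θ

⨁-⊢⁻ : ∀ {I : Set} (f : I → Proc) (L : List⁺ I) {Θ} → ⨁ f L ⊢ Θ → Branches f L Θ
⨁-⊢⁻ f (c List⁺.∷ []) ⊢S (here refl) = ⊢S
⨁-⊢⁻ f (c List⁺.∷ (c′ ∷ cs)) ⊢S (here refl) = proj₁ (choice-⊢⁻ ⊢S)
⨁-⊢⁻ f (c List⁺.∷ (c′ ∷ cs)) ⊢S (there c∈) = ⨁-⊢⁻ f (c′ List⁺.∷ cs) (proj₂ (choice-⊢⁻ ⊢S)) c∈

⊞-list-⊢⁺ : ∀ {I : Set} (f : I → Proc) c cs {Θ} → (∀ {c′} → c′ ∈ c ∷ cs → f c′ ⊢ Θ) →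
  ⊞-list (f c) (map f cs) ⊢ Θ
⊞-list-⊢⁺ f c [] ⊢f = ⊢f (here refl)
⊞-list-⊢⁺ f c (c′ ∷ cs) ⊢f = t-choice (⊢f (here refl)) (⊞-list-⊢⁺ f c′ cs (⊢f ∘ there))

⨁-⊢⁺ : ∀ {I : Set} (f : I → Proc) (L : List⁺ I) {Θ} → Branches f L Θ → ⨁ f L ⊢ Θ
⨁-⊢⁺ f (c List⁺.∷ cs) = ⊞-list-⊢⁺ f c cs

head∈ : ∀ {I : Set} (L : List⁺ I) → List⁺.head L ∈ toList L
head∈ (c List⁺.∷ cs) = here refl

names-⨁ : ∀ {I : Set} (f : I → Proc) (L : List⁺ I) {c z} → c ∈ toList L → z ∈ names (f c) →
  z ∈ names (⨁ f L)
names-⨁ f (c List⁺.∷ []) (here refl) z∈ = z∈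
names-⨁ f (c List⁺.∷ (c′ ∷ cs)) (here refl) z∈ = ∈-++⁺ˡ z∈
names-⨁ f (c List⁺.∷ (c′ ∷ cs)) (there c∈) z∈ = ∈-++⁺ʳ (names (f c)) (names-⨁ f (c′ List⁺.∷ cs) c∈ z∈)

names-plug : ∀ C {X z} → z ∈ names X → z ∈ names (plug C X)
names-plug hole z∈ = z∈
names-plug (C ∥ₙ R) z∈ = ∈-++⁺ˡ (names-plug C z∈)
names-plug (nuₙ v C R) z∈ = there (∈-++⁺ˡ (names-plug C z∈))

bv⊆names-plug : ∀ C {X z} → z ∈ bv C → z ∈ names (plug C X)
bv⊆names-plug (C ∥ₙ R) z∈ = ∈-++⁺ˡ (bv⊆names-plug C z∈)
bv⊆names-plug (nuₙ v C R) (here refl) = here refl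
bv⊆names-plug (nuₙ v C R) (there z∈) = there (∈-++⁺ˡ (bv⊆names-plug C z∈))

⊞*-⊢⁻ : ∀ {P Qs Θ} → (P ⊞* Qs) ⊢ Θ → P ⊢ Θ
⊞*-⊢⁻ {Qs = []} ⊢S = ⊢S
⊞*-⊢⁻ {Qs = _ ∷ _} ⊢S = proj₁ (choice-⊢⁻ ⊢S)

-- The precongruence only discards branches of a sum.
⪰⇒⊢⇒ : ∀ {P S P′} → P ⪰[ S ] P′ → P ⊢⇒ P′
⪰⇒⊢⇒ (pc-one _ _ _ _ _ _ _) = ⊞*-⊢⁻
⪰⇒⊢⇒ (pc-two {x = x} _ _ _ J K _ _ _) =
  ⊞*-⊢⁻ {Qs = map (λ (C , z) → plug C (fwd x z)) J} ∘ ⊞*-⊢⁻ {Qs = map fillI K}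

plugN-⊢⇒ : ∀ N {X Y} → X ⊢⇒ Y → plugN N X ⊢⇒ plugN N Y
plugN-⊢⇒ hole X⇒ = X⇒
plugN-⊢⇒ (N ∥ₙ P) X⇒ = ⊢⇒-par (plugN-⊢⇒ N X⇒) id
plugN-⊢⇒ (nuₙ x N P) X⇒ = ⊢⇒-nu (plugN-⊢⇒ N X⇒) id
plugN-⊢⇒ (N ⊞ₙ P) X⇒ = ⊢⇒-choice (plugN-⊢⇒ N X⇒) id

plug-⊞-distrib : ∀ C {Q₁ Q₂} → plug C (Q₁ ⊞ Q₂) ⊢⇒ (plug C Q₁ ⊞ plug C Q₂)
plug-⊞-distrib C ⊢S with plug-⊢⁻ C ⊢S
... | _ , ⊢Q , ct = let ⊢Q₁ , ⊢Q₂ = choice-⊢⁻ ⊢Q in t-choice (plug-⊢⁺ ct ⊢Q₁) (plug-⊢⁺ ct ⊢Q₂)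

-- Firing a prefix inside a D-context

lookupB-typed : ∀ {Γ x b} {bs : Br b} {F k Q} → BrTyped Γ x bs F → lookupB bs k ≡ just Q →
  ∃[ A ] (lookupF F k ≡ just A) × (Q ⊢ (x , A) ∷ Γ)
lookupB-typed {k = k} (bt-one {ℓ = ℓ} ⊢P) eq with k == ℓ
lookupB-typed (bt-one ⊢P) refl | true = _ , refl , ⊢P
lookupB-typed (bt-one ⊢P) () | false
lookupB-typed {k = k} (bt-more {ℓ = ℓ} ⊢P bt) eq with k == ℓ
lookupB-typed (bt-more ⊢P bt) refl | true = _ , refl , ⊢P
lookupB-typed (bt-more ⊢P bt) eq | false = lookupB-typed bt eq

lookupF-dual : ∀ {b} (F : TyFam b) k → lookupF (dualF F) k ≡ Maybe.map dual (lookupF F k)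
lookupF-dual (one ℓ p A) k with k == ℓ
... | true = refl
... | false = refl
lookupF-dual (more ℓ p A F) k with k == ℓ
... | true = refl
... | false = lookupF-dual F k

noneAll-⊢ : ∀ ws Γ → AllAmp Γ → WF Γ → ws ↭ dom Γ → noneAll ws ⊢ Γ
unavail-noneAll-⊢ : ∀ w ws Γ A → AllAmp Γ → WF ((w , & A) ∷ Γ) → ws ↭ dom Γ →
  noneAll (w ∷ ws) ⊢ (w , & A) ∷ Γ
noneAll-⊢ [] [] _ _ _ = t-inact
noneAll-⊢ [] (_ ∷ _) _ _ ws↭ with ↭-empty-inv (↭-sym ws↭)
... | ()
noneAll-⊢ (w ∷ ws) Γ amp wf ws↭ with ∈-dom⇒↭ Γ (∈-resp-↭ ws↭ (here refl))
... | _ , Γ′ , pΓ with All-resp-↭ pΓ amp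
... | (A , refl) ∷ amp′ =
  t-exch (unavail-noneAll-⊢ w ws Γ′ A amp′ (WF-resp-↭ pΓ wf) (drop-∷ (↭-trans ws↭ (↭-map⁺ proj₁ pΓ))))
         (↭-sym pΓ)
unavail-noneAll-⊢ w [] [] A _ _ _ = t-unavail
unavail-noneAll-⊢ w [] (_ ∷ _) A _ _ ws↭ with ↭-empty-inv (↭-sym ws↭)
... | ()
unavail-noneAll-⊢ w (v ∷ ws) Γ A amp wf ws↭ =
  t-mix wf t-unavail (noneAll-⊢ (v ∷ ws) Γ amp (Unique-tail wf) ws↭)

plug-close-⊢ : ∀ C {x T Γ} → plug C (close x) ⊢ (x , T) ∷ Γ → x ∉ bv C → plug C inact ⊢ Γ
plug-close-⊢ C ⊢C x∉ with focus C (here refl) ⊢C x∉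
... | focused _ ⊢X _ refill with ↭-empty-inv (↭-sym (proj₂ (↭-head-cancel (⊢⇒WF ⊢X) (close-⊢⁻ ⊢X))))
... | refl = refill [] (no-binders C) (Unique-tail (⊢⇒WF ⊢C)) t-inact

plug-unavail-⊢ : ∀ C {x T Γ} → plug C (unavail x) ⊢ (x , T) ∷ Γ → x ∉ bv C → plug C inact ⊢ Γ
plug-unavail-⊢ C ⊢C x∉ with focus C (here refl) ⊢C x∉
... | focused _ ⊢X _ refill with unavail-⊢⁻ ⊢X
... | _ , q with ↭-empty-inv (↭-sym (proj₂ (↭-head-cancel (⊢⇒WF ⊢X) q)))
... | refl = refill [] (no-binders C) (Unique-tail (⊢⇒WF ⊢C)) t-inact

plug-wait-⊢ : ∀ C {x Q T Γ} → plug C (wait x Q) ⊢ (x , T) ∷ Γ → x ∉ bv C → plug C Q ⊢ Γ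
plug-wait-⊢ C ⊢C x∉ with focus C (here refl) ⊢C x∉
... | focused _ ⊢X _ refill with wait-⊢⁻ ⊢X
... | _ , ⊢Q , q =
  refill [] (no-binders C) (Unique-tail (⊢⇒WF ⊢C)) (t-exch ⊢Q (proj₂ (↭-head-cancel (⊢⇒WF ⊢X) q)))

plug-expect-none-⊢ : ∀ C {x ws Q T Γ} → plug C (expect x ws Q) ⊢ (x , T) ∷ Γ → x ∉ bv C →
  plug C (noneAll ws) ⊢ Γ
plug-expect-none-⊢ C {ws = ws} ⊢C x∉ with focus C (here refl) ⊢C x∉
... | focused _ ⊢X _ refill with expect-⊢⁻ ⊢X
... | Γ′ , _ , amp , ws↭ , ⊢Q , q =
  refill [] (no-binders C) (Unique-tail (⊢⇒WF ⊢C))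
    (t-exch (noneAll-⊢ ws Γ′ amp (Unique-tail (⊢⇒WF ⊢Q)) ws↭) (proj₂ (↭-head-cancel (⊢⇒WF ⊢X) q)))

plug-avail-type : ∀ C {x P T Γ} → plug C (avail x P) ⊢ (x , T) ∷ Γ → x ∉ bv C → ∃[ A ] T ≡ & A
plug-avail-type C ⊢C x∉ with focus C (here refl) ⊢C x∉
... | focused _ ⊢X _ _ with avail-⊢⁻ ⊢X
... | _ , A , _ , q = A , sym (proj₁ (↭-head-cancel (⊢⇒WF ⊢X) q))

plug-avail-⊢ : ∀ C {x P A Γ} → plug C (avail x P) ⊢ (x , & A) ∷ Γ → x ∉ bv C → plug C P ⊢ (x , A) ∷ Γ
plug-avail-⊢ C ⊢C x∉ with focus C (here refl) ⊢C x∉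
... | focused _ ⊢X _ refill with avail-⊢⁻ ⊢X
... | _ , _ , ⊢P , q with ↭-head-cancel (⊢⇒WF ⊢X) q
... | refl , p = refill (_ ∷ []) (fresh-binder C x∉) (⊢⇒WF ⊢C) (t-exch ⊢P (↭-prep _ p))

plug-expect-some-⊢ : ∀ C {x ws Q A Γ} → plug C (expect x ws Q) ⊢ (x , ⊕ A) ∷ Γ → x ∉ bv C →
  plug C Q ⊢ (x , A) ∷ Γ
plug-expect-some-⊢ C ⊢C x∉ with focus C (here refl) ⊢C x∉
... | focused _ ⊢X _ refill with expect-⊢⁻ ⊢X
... | _ , _ , _ , _ , ⊢Q , q with ↭-head-cancel (⊢⇒WF ⊢X) q
... | refl , p = refill (_ ∷ []) (fresh-binder C x∉) (⊢⇒WF ⊢C) (t-exch ⊢Q (↭-prep _ p))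

plug-sel-type : ∀ C {x k P T Γ} → plug C (sel x k P) ⊢ (x , T) ∷ Γ → x ∉ bv C →
  ∃[ F ] ∃[ A ] (T ≡ ⊕⟨ F ⟩) × (lookupF F k ≡ just A)
plug-sel-type C ⊢C x∉ with focus C (here refl) ⊢C x∉
... | focused _ ⊢X _ _ with sel-⊢⁻ ⊢X
... | _ , F , A , eq , _ , q = F , A , sym (proj₁ (↭-head-cancel (⊢⇒WF ⊢X) q)) , eq

plug-sel-⊢ : ∀ C {x k P F A Γ} → plug C (sel x k P) ⊢ (x , ⊕⟨ F ⟩) ∷ Γ → lookupF F k ≡ just A →
  x ∉ bv C → plug C P ⊢ (x , A) ∷ Γ
plug-sel-⊢ C ⊢C F[k]≡A x∉ with focus C (here refl) ⊢C x∉
... | focused _ ⊢X _ refill with sel-⊢⁻ ⊢X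
... | _ , _ , _ , F[k]≡A′ , ⊢P , q with ↭-head-cancel (⊢⇒WF ⊢X) q
... | refl , p with trans (sym F[k]≡A′) F[k]≡A
... | refl = refill (_ ∷ []) (fresh-binder C x∉) (⊢⇒WF ⊢C) (t-exch ⊢P (↭-prep _ p))

plug-bra-⊢ : ∀ C {x k bs Q F A Γ} → plug C (bra x bs) ⊢ (x , &⟨ dualF F ⟩) ∷ Γ → lookupF F k ≡ just A →
  lookupB bs k ≡ just Q → x ∉ bv C → plug C Q ⊢ (x , dual A) ∷ Γ
plug-bra-⊢ C {k = k} {F = F} ⊢C F[k]≡A bs[k]≡Q x∉ with focus C (here refl) ⊢C x∉
... | focused _ ⊢X _ refill with bra-⊢⁻ ⊢X
... | _ , _ , bt , q with ↭-head-cancel (⊢⇒WF ⊢X) q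
... | refl , p with lookupB-typed bt bs[k]≡Q
... | _ , F̄[k]≡A′ , ⊢Q
    with trans (sym F̄[k]≡A′) (trans (lookupF-dual F k) (cong (Maybe.map dual) F[k]≡A))
... | refl = refill (_ ∷ []) (fresh-binder C x∉) (⊢⇒WF ⊢C) (t-exch ⊢Q (↭-prep _ p))

plug-fwd-⊢ : ∀ C {x y T Γ Q Δ} → plug C (fwd x y) ⊢ (x , T) ∷ Γ → x ∉ bv C → Q ⊢ (x , dual T) ∷ Δ →
  Avoids C (dom Δ) → WF (Δ ++ Γ) → plug C (Q [ y / x ]) ⊢ Δ ++ Γ
plug-fwd-⊢ C {y = y} {T} {Q = Q} {Δ} ⊢C x∉ ⊢Q av w with focus C (here refl) ⊢C x∉
... | focused Φ ⊢X WF-refill refill with fwd-⊢⁻ ⊢X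
... | _ , q with ↭-head-cancel (⊢⇒WF ⊢X) q
... | refl , p =
  refill Δ av w (t-exch (subst-⊢ ⊢Q y∉Δ) (↭-trans (++-comm ((y , dual T) ∷ []) Δ) (++⁺ˡ Δ p)))
  where
  y∉Δ : y ∉ dom Δ
  y∉Δ y∈ = WF-++⇒Disjoint Δ Φ (WF-refill Δ av w) (y∈ , ∈-dom-resp-↭ p (here refl))

plug-inp-⊢ : ∀ C {x z R A B Δ w} → plug C (inp x z R) ⊢ (x , dual (A ⊗ B)) ∷ Δ → x ∉ bv C →
  w ∉ names (plug C (inp x z R)) → w ∉ dom Δ →
  plug C (R [ w / z ]) ⊢ (w , dual A) ∷ (x , dual B) ∷ Δ
plug-inp-⊢ C {x} {Δ = Δ} {w} ⊢C x∉ w∉ w∉Δ with focus C (here refl) ⊢C x∉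
... | focused _ ⊢X _ refill with inp-⊢⁻ ⊢X
... | Γ′ , _ , _ , ⊢R , q with ↭-head-cancel (⊢⇒WF ⊢X) q
... | refl , p =
  refill (_ ∷ _ ∷ []) av (Unique-∷⁺ w∉xΔ (⊢⇒WF ⊢C)) (t-exch (subst-⊢ ⊢R w∉xΓ′) (↭-prep _ (↭-prep _ p)))
  where
  w≢x : w ≢ x
  w≢x refl = w∉ (names-plug C (here refl))
  w∉xΔ : w ∉ x ∷ dom Δ
  w∉xΔ (here refl) = w≢x refl
  w∉xΔ (there w∈) = w∉Δ w∈
  w∉xΓ′ : w ∉ x ∷ dom Γ′
  w∉xΓ′ (here refl) = w≢x refl
  w∉xΓ′ (there w∈) = w∉ (names-plug C (there (there (dom⊆names ⊢R (there (there w∈))))))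
  av : Avoids C (w ∷ x ∷ [])
  av z∈bv (here refl) = w∉ (bv⊆names-plug C z∈bv)
  av z∈bv (there (here refl)) = x∉ z∈bv

plug-out-type : ∀ C {x y P Q T Γ} → plug C (out x y P Q) ⊢ (x , T) ∷ Γ → x ∉ bv C →
  ∃[ A ] ∃[ B ] T ≡ A ⊗ B
plug-out-type C ⊢C x∉ with focus C (here refl) ⊢C x∉
... | focused _ ⊢X _ _ with out-⊢⁻ ⊢X
... | _ , _ , A , B , _ , _ , q = A , B , sym (proj₁ (↭-head-cancel (⊢⇒WF ⊢X) q))

comm-⊢ : ∀ {x y w P Q R Γ Δ Ψ A B} →
  P ⊢ (y , A) ∷ Γ → Q ⊢ (x , B) ∷ Δ → R ⊢ (w , dual A) ∷ (x , dual B) ∷ Ψ →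
  w ∉ dom Γ → x ∉ dom Γ → WF (Ψ ++ Γ ++ Δ) → nu x Q (nu w (P [ w / y ]) R) ⊢ Ψ ++ Γ ++ Δ
comm-⊢ {x} {y} {w} {P} {R = R} {Γ} {Δ} {Ψ} {B = B} ⊢P ⊢Q ⊢R w∉Γ x∉Γ wΨΓΔ =
  t-exch (t-cut (WF-resp-↭ ΨΓΔ↭ΔΓΨ wΨΓΔ) ⊢Q (t-exch inner (shift (x , dual B) Γ Ψ))) (↭-sym ΨΓΔ↭ΔΓΨ)
  where
  ΨΓΔ↭ΔΓΨ : Ψ ++ Γ ++ Δ ↭ Δ ++ Γ ++ Ψ
  ΨΓΔ↭ΔΓΨ = ↭-solve 3 (λ a b c → a ⊕ (b ⊕ c) ⊜ c ⊕ (b ⊕ a)) ↭-refl Ψ Γ Δ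
  wΓΨ : WF (Γ ++ Ψ)
  wΓΨ = WF-++⁻ʳ Δ (Γ ++ Ψ) (WF-resp-↭ ΨΓΔ↭ΔΓΨ wΨΓΔ)
  x∉ΓΨ : x ∉ dom (Γ ++ Ψ)
  x∉ΓΨ x∈ = [ x∉Γ , Unique-∷⁻ (Unique-tail (⊢⇒WF ⊢R)) ]′ (∈-dom-++⁻ Γ Ψ x∈)
  inner : nu w (P [ w / y ]) R ⊢ Γ ++ (x , dual B) ∷ Ψ
  inner = t-cut (WF-resp-↭ (↭-sym (shift (x , dual B) Γ Ψ)) (Unique-∷⁺ x∉ΓΨ wΓΨ)) (subst-⊢ ⊢P w∉Γ) ⊢R

plug-out-⊢ : ∀ C {x y P Q A B Γ R Ψ w} → plug C (out x y P Q) ⊢ (x , A ⊗ B) ∷ Γ → x ∉ bv C →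
  R ⊢ (w , dual A) ∷ (x , dual B) ∷ Ψ → Avoids C (dom Ψ) → WF (Ψ ++ Γ) →
  w ∉ names (plug C (out x y P Q)) → plug C (nu x Q (nu w (P [ w / y ]) R)) ⊢ Ψ ++ Γ
plug-out-⊢ C {x} {Ψ = Ψ} {w} ⊢C x∉ ⊢R av wf w∉ with focus C (here refl) ⊢C x∉
... | focused _ ⊢X WF-refill refill with out-⊢⁻ ⊢X
... | Γ′ , Δ′ , _ , _ , ⊢P , ⊢Q , q with ↭-head-cancel (⊢⇒WF ⊢X) q
... | refl , p =
  refill Ψ av wf
    (t-exch (comm-⊢ ⊢P ⊢Q ⊢R w∉Γ′ x∉Γ′ (WF-resp-↭ (↭-sym (++⁺ˡ Ψ p)) (WF-refill Ψ av wf))) (++⁺ˡ Ψ p))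
  where
  w∉Γ′ : w ∉ dom Γ′
  w∉Γ′ = w∉ ∘ names-plug C ∘ there ∘ there ∘ ∈-++⁺ˡ ∘ dom⊆names ⊢P ∘ there
  x∉Γ′ : x ∉ dom Γ′
  x∉Γ′ = ⊢-head∉ ⊢X ∘ ∈-dom-resp-↭ p ∘ ∈-dom-++⁺ˡ Γ′ Δ′

nu-⨁-⊢⁻ : ∀ {I J : Set} {x} (f : I → Proc) (Cs : List⁺ I) (g : J → Proc) (Ds : List⁺ J) {Θ} →
  nu x (⨁ f Cs) (⨁ g Ds) ⊢ Θ →
  ∃[ Γ ] ∃[ Δ ] ∃[ T ] Branches f Cs ((x , T) ∷ Γ) × Branches g Ds ((x , dual T) ∷ Δ) × (Γ ++ Δ ↭ Θ)
nu-⨁-⊢⁻ f Cs g Ds ⊢S with nu-⊢⁻ ⊢S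
... | Γ , Δ , T , ⊢L , ⊢R , q = Γ , Δ , T , ⨁-⊢⁻ f Cs ⊢L , ⨁-⊢⁻ g Ds ⊢R , q

Avoids-⊆ : ∀ C {ns ms} → (∀ {z} → z ∈ ns → z ∈ ms) → Avoids C ms → Avoids C ns
Avoids-⊆ C ns⊆ms av z∈bv = av z∈bv ∘ ns⊆ms

Avoids-head : ∀ C {x ns} → Avoids C (x ∷ ns) → x ∉ bv C
Avoids-head C av x∈bv = av x∈bv (here refl)

id-⊢⇒ : ∀ {x y Q} (Cs : List⁺ DCtx) →
  (∀ {C} → C ∈ toList Cs → Avoids C (x ∷ y ∷ fn (nu x (⨁ (λ C → plug C (fwd x y)) Cs) Q))) →
  nu x (⨁ (λ C → plug C (fwd x y)) Cs) Q ⊢⇒ ⨁ (λ C → plug C (Q [ y / x ])) Cs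
id-⊢⇒ {x} {y} {Q} Cs av ⊢S with nu-⊢⁻ ⊢S
... | Γ , Δ , _ , ⊢L , ⊢Q , q = t-exch (⨁-⊢⁺ _ Cs branch) ΔΓ↭
  where
  ΔΓ↭ : Δ ++ Γ ↭ _
  ΔΓ↭ = ↭-trans (++-comm Δ Γ) q
  branch : Branches (λ C → plug C (Q [ y / x ])) Cs (Δ ++ Γ)
  branch {C} C∈ =
    plug-fwd-⊢ C (⨁-⊢⁻ _ Cs ⊢L C∈) (Avoids-head C (av C∈)) ⊢Q
      (Avoids-⊆ C (there ∘ there ∘ dom⊆fn ⊢S ∘ ∈-dom-resp-↭ q ∘ ∈-dom-++⁺ʳ Γ Δ) (av C∈))
      (↭⊢⇒WF ΔΓ↭ ⊢S)

close-⊢⇒ : ∀ {x} (Cs : List⁺ DCtx) (Ds : List⁺ CtxProc) →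
  (∀ {C} → C ∈ toList Cs → x ∉ bv C) → (∀ {d} → d ∈ toList Ds → x ∉ bv (CtxProc.cctx d)) →
  nu x (⨁ (λ C → plug C (close x)) Cs) (⨁ (λ (ctxProc D Q) → plug D (wait x Q)) Ds)
    ⊢⇒ (⨁ (λ C → plug C inact) Cs ∥ ⨁ (λ (ctxProc D Q) → plug D Q) Ds)
close-⊢⇒ Cs Ds x∉C x∉D ⊢S with nu-⨁-⊢⁻ _ Cs _ Ds ⊢S
... | _ , _ , _ , ⊢L , ⊢R , q =
  mix-↭ (⨁-⊢⁺ _ Cs λ {C} C∈ → plug-close-⊢ C (⊢L C∈) (x∉C C∈))
        (⨁-⊢⁺ _ Ds λ {d} d∈ → plug-wait-⊢ (CtxProc.cctx d) (⊢R d∈) (x∉D d∈))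
        (⊢⇒WF ⊢S) q

none-⊢⇒ : ∀ {x ws} (Cs : List⁺ DCtx) (Ds : List⁺ CtxProc) →
  (∀ {C} → C ∈ toList Cs → x ∉ bv C) → (∀ {d} → d ∈ toList Ds → x ∉ bv (CtxProc.cctx d)) →
  nu x (⨁ (λ C → plug C (unavail x)) Cs) (⨁ (λ (ctxProc D Q) → plug D (expect x ws Q)) Ds)
    ⊢⇒ (⨁ (λ C → plug C inact) Cs ∥ ⨁ (λ (ctxProc D _) → plug D (noneAll ws)) Ds)
none-⊢⇒ Cs Ds x∉C x∉D ⊢S with nu-⨁-⊢⁻ _ Cs _ Ds ⊢S
... | _ , _ , _ , ⊢L , ⊢R , q =
  mix-↭ (⨁-⊢⁺ _ Cs λ {C} C∈ → plug-unavail-⊢ C (⊢L C∈) (x∉C C∈))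
        (⨁-⊢⁺ _ Ds λ {d} d∈ → plug-expect-none-⊢ (CtxProc.cctx d) (⊢R d∈) (x∉D d∈))
        (⊢⇒WF ⊢S) q

some-⊢⇒ : ∀ {x ws} (Cs Ds : List⁺ CtxProc) →
  (∀ {c} → c ∈ toList Cs → x ∉ bv (CtxProc.cctx c)) → (∀ {d} → d ∈ toList Ds → x ∉ bv (CtxProc.cctx d)) →
  nu x (⨁ (λ (ctxProc C P) → plug C (avail x P)) Cs) (⨁ (λ (ctxProc D Q) → plug D (expect x ws Q)) Ds)
    ⊢⇒ nu x (⨁ (λ (ctxProc C P) → plug C P) Cs) (⨁ (λ (ctxProc D Q) → plug D Q) Ds)
some-⊢⇒ Cs Ds x∉C x∉D ⊢S with nu-⨁-⊢⁻ _ Cs _ Ds ⊢S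
... | _ , _ , _ , ⊢L , ⊢R , q with plug-avail-type _ (⊢L (head∈ Cs)) (x∉C (head∈ Cs))
... | _ , refl =
  cut-↭ (⨁-⊢⁺ _ Cs λ {c} c∈ → plug-avail-⊢ (CtxProc.cctx c) (⊢L c∈) (x∉C c∈))
        (⨁-⊢⁺ _ Ds λ {d} d∈ → plug-expect-some-⊢ (CtxProc.cctx d) (⊢R d∈) (x∉D d∈))
        (⊢⇒WF ⊢S) q

sel-⊢⇒ : ∀ {x k} (Cs : List⁺ CtxProc) (Ds : List⁺ BraItem) →
  (∀ {d} → d ∈ toList Ds → lookupB (BraItem.bbr d) k ≡ just (BraItem.bsel d)) →
  (∀ {c} → c ∈ toList Cs → x ∉ bv (CtxProc.cctx c)) → (∀ {d} → d ∈ toList Ds → x ∉ bv (BraItem.bctx d)) →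
  nu x (⨁ (λ (ctxProc C P) → plug C (sel x k P)) Cs) (⨁ (λ (braItem D bs _) → plug D (bra x bs)) Ds)
    ⊢⇒ nu x (⨁ (λ (ctxProc C P) → plug C P) Cs) (⨁ (λ (braItem D _ Q) → plug D Q) Ds)
sel-⊢⇒ Cs Ds selected x∉C x∉D ⊢S with nu-⨁-⊢⁻ _ Cs _ Ds ⊢S
... | _ , _ , _ , ⊢L , ⊢R , q with plug-sel-type _ (⊢L (head∈ Cs)) (x∉C (head∈ Cs))
... | _ , _ , refl , F[k]≡A =
  cut-↭ (⨁-⊢⁺ _ Cs λ {c} c∈ → plug-sel-⊢ (CtxProc.cctx c) (⊢L c∈) F[k]≡A (x∉C c∈))
        (⨁-⊢⁺ _ Ds λ {d} d∈ → plug-bra-⊢ (BraItem.bctx d) (⊢R d∈) F[k]≡A (selected d∈) (x∉D d∈))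
        (⊢⇒WF ⊢S) q

comm-⊢⇒ : ∀ x Cs z Ds w →
  (∀ {c} → c ∈ toList Cs → Avoids (OutItem.octx c) (x ∷ fn (commL x Cs z Ds))) →
  (∀ {d} → d ∈ toList Ds → x ∉ bv (CtxProc.cctx d)) → w ∉ names (commL x Cs z Ds) →
  commL x Cs z Ds ⊢⇒ commR x Cs z Ds w
comm-⊢⇒ x Cs z Ds w avC x∉D w∉ ⊢S with nu-⨁-⊢⁻ _ Cs _ Ds ⊢S
... | Γ , Δ , _ , ⊢L , ⊢R , q
    with plug-out-type _ (⊢L (head∈ Cs)) (Avoids-head (OutItem.octx (List⁺.head Cs)) (avC (head∈ Cs)))
... | A , B , refl = t-exch (⨁-⊢⁺ _ Cs sender) q
  where
  continuation : Proc
  continuation = ⨁ (λ (ctxProc D R) → plug D (R [ w / z ])) Ds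
  Δ⊆fn : ∀ {u} → u ∈ dom Δ → u ∈ fn (commL x Cs z Ds)
  Δ⊆fn = dom⊆fn ⊢S ∘ ∈-dom-resp-↭ q ∘ ∈-dom-++⁺ʳ Γ Δ
  ⊢continuation : continuation ⊢ (w , dual A) ∷ (x , dual B) ∷ Δ
  ⊢continuation = ⨁-⊢⁺ _ Ds λ {d} d∈ →
    plug-inp-⊢ (CtxProc.cctx d) (⊢R d∈) (x∉D d∈)
      (w∉ ∘ there ∘ ∈-++⁺ʳ (names (⨁ _ Cs)) ∘ names-⨁ _ Ds d∈)
      (w∉ ∘ fn⊆names (commL x Cs z Ds) ∘ Δ⊆fn)
  sender : Branches (λ (outItem C y P Q) → plug C (nu x Q (nu w (P [ w / y ]) continuation))) Cs (Γ ++ Δ)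
  sender {outItem C _ _ _} c∈ =
    t-exch (plug-out-⊢ C (⊢L c∈) (Avoids-head C (avC c∈)) ⊢continuation
                       (Avoids-⊆ C (there ∘ Δ⊆fn) (avC c∈)) (↭⊢⇒WF (↭-trans (++-comm Δ Γ) q) ⊢S)
                       (w∉ ∘ there ∘ ∈-++⁺ˡ ∘ names-⨁ _ Cs c∈))
           (++-comm Δ Γ)

subject-reduction : ∀ {S P Q} → P ⇝[ S ] Q → P ⊢⇒ Q
subject-reduction (r-id _ Cs av) = id-⊢⇒ Cs av
subject-reduction (r-comm {x = x} _ Cs z Ds w avC avD w∉) =
  comm-⊢⇒ x Cs z Ds w avC (λ {d} d∈ → Avoids-head (CtxProc.cctx d) (avD d∈)) w∉
subject-reduction (r-sel _ _ Cs _ Ds _ selected _ avC avD) =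
  sel-⊢⇒ Cs Ds selected (λ {c} c∈ → Avoids-head (CtxProc.cctx c) (avC c∈))
                        (λ {d} d∈ → Avoids-head (BraItem.bctx d) (avD d∈))
subject-reduction (r-close _ Cs Ds avC avD) =
  close-⊢⇒ Cs Ds (λ {C} C∈ → Avoids-head C (avC C∈)) (λ {d} d∈ → Avoids-head (CtxProc.cctx d) (avD d∈))
subject-reduction (r-some _ Cs _ Ds avC avD) =
  some-⊢⇒ Cs Ds (λ {c} c∈ → Avoids-head (CtxProc.cctx c) (avC c∈))
                (λ {d} d∈ → Avoids-head (CtxProc.cctx d) (avD d∈))
subject-reduction (r-none _ Cs _ Ds avC avD) =
  none-⊢⇒ Cs Ds (λ {C} C∈ → Avoids-head C (avC C∈)) (λ {d} d∈ → Avoids-head (CtxProc.cctx d) (avD d∈))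
subject-reduction (r-pre _ P⪰P′ Q⪰Q′ P′Q′⇝R) = subject-reduction P′Q′⇝R ∘ ⊢⇒-nu (⪰⇒⊢⇒ P⪰P′) (⪰⇒⊢⇒ Q⪰Q′)
subject-reduction (r-nu-choice N C ⇝R) = subject-reduction ⇝R ∘ ⊢⇒-nu id (plugN-⊢⇒ N (plug-⊞-distrib C))
subject-reduction (r-struct P≡P′ P′⇝Q′ Q′≡Q) =
  proj₁ (≡ₛ⇒⊢⇔ Q′≡Q) ∘ subject-reduction P′⇝Q′ ∘ proj₁ (≡ₛ⇒⊢⇔ P≡P′)
subject-reduction (r-ctx-nu P⇝P′) = ⊢⇒-nu (subject-reduction P⇝P′) id
subject-reduction (r-ctx-par P⇝P′) = ⊢⇒-par (subject-reduction P⇝P′) id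
subject-reduction (r-ctx-choice P⇝P′) = ⊢⇒-choice (subject-reduction P⇝P′) id

mainTheorem1 : ∀ {P : Proc} {Γ : Ctx} → P ⊢ Γ →
    ((Q : Proc) → P ≡ₛ Q → Q ⊢ Γ)
    × ((Q : Proc) (S : List Name) → S ≢ [] → P ⇝[ S ] Q → Q ⊢ Γ)
mainTheorem1 ⊢P =
  (λ Q P≡Q → proj₁ (≡ₛ⇒⊢⇔ P≡Q) ⊢P) ,
  (λ Q S _ P⇝Q → subject-reduction P⇝Q ⊢P)
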